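{- For any $n\geq1$ and $w\in\{+,-\}^n$, we have \begin{align*} Q^+_{w+}&=\Phi_{2,2,1}(Q^-_w)+\Phi_{3,1,2}(Q^+_w),\\ Q^-_{w+}&=\Phi_{1,1,3}(Q^+_w),\\ Q^+_{w- }&=\Phi_{1,1,2}(Q^-_w),\\ Q^-_{w- }&=\Phi_{3,3,1}(Q^+_w)+\Phi_{2,1,3}(Q^-_w). \end{align*}
   Context: A total cyclic order on a finite set $X$ is a set $Z$ of triples of distinct elements of $X$ such that: $(x,y,z)\in Z\Rightarrow (y,z,x)\in Z$; $(x,y,z)\in Z\Rightarrow (z,y,x)\notin Z$; $(x,y,z)\in Z$ and $(x,z,u)\in Z\Rightarrow (x,y,u)\in Z$; and for any three distinct $x,y,z$, either $(x,y,z)\in Z$ or $(z,y,x)\in Z$. For $w=\epsilon_1\cdots\epsilon_{m-2}\in\{+,-\}^{m-2}$ ($m\geq3$), $\mathcal{P}_w$ is the set of total cyclic orders $Z$ on $[m]$ such that for every $1\leq i\leq m-2$, $(i,i+1,i+2)\in Z$ if $\epsilon_i=+$ and $(i+2,i+1,i)\in Z$ if $\epsilon_i=-$. $\mathcal{Q}^+_w$ (resp. $\mathcal{Q}^-_w$) is the set of $Z\in\mathcal{P}_w$ with $(m-1,m,1)\in Z$ (resp. $(1,m,m-1)\in Z$). Let $c_Z(a,b)=\#\{x:(a,x,b)\in Z\}$ and $\tilde c_Z(y_1,\dots,y_p)=(c_Z(y_1,y_2),\dots,c_Z(y_{p-1},y_p),c_Z(y_p,y_1))$. For $w\in\{+,-\}^{m-2}$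 and $i+j+k=m-3$, $f^+_{w,i,j,k}=\#\{Z\in\mathcal{Q}^+_w:\tilde c_Z(m-1,m,1)=(i,j,k)\}$ and $f^-_{w,i,j,k}=\#\{Z\in\mathcal{Q}^-_w:\tilde c_Z(m,m-1,1)=(i,j,k)\}$. For $w\in\{+,-\}^n$ and $\eta\in\{+,-\}$, $Q^\eta_w(X_1,X_2,X_3)=\sum_{i+j+k=n-1} f^\eta_{w,i,j,k}X_1^iX_2^jX_3^k$. The words $w+$, $w-$ are $w$ with $+$, resp. $-$, appended. For $m'\geq2$ and $1\leq a,b,c\leq m'$ with $b\neq c$, $\Phi_{a,b,c}$ is the linear endomorphism of $\mathbb{Z}[X_1,\dots,X_{m'}]$ defined on monomials by $\Phi_{a,b,c}\left(\prod_{\ell} X_\ell^{i_\ell}\right)=\left(\prod_{\ell\notin\{b,c\}}X_\ell^{i_\ell}\right)X_a^{i_b+1}\sum_{k=0}^{i_c}X_b^{i_c-k}X_c^{k}$ (here with $m'=3$). -}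

module Defs where

open import Data.Nat using (ℕ; zero; suc; _+_; _∸_; _≟_)
open import Data.Integer using (ℤ; +_) renaming (_+_ to _+ℤ_)
open import Data.Fin using (Fin; zero; suc; inject₁; fromℕ) renaming (_≟_ to _≟F_)
open import Data.Fin.Properties using (all?)
open import Data.Bool using (Bool; true; false; T; T?; if_then_else_; _∨_)
open import Data.List using (List; []; _∷_; _++_; map; concatMap; length; filter; upTo; allFin; foldr)
open import Data.Vec using (Vec; lookup)
open import Data.Product using (_×_; _,_)
open import Data.Sum using (_⊎_)
open import Relation.Nullary using (¬_; Dec; ¬?)
open import Relation.Nullary.Decidable using (_×-dec_; _⊎-dec_; _→-dec_; ⌊_⌋)
open import Relation.Binary.PropositionalEquality using (_≡_; _≢_)

data Sign : Set where
  ⊕ ⊖ : Sign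

-- Ternary relations on [m].  [m] = {1,…,m} is modelled by Fin m,
-- the element i ∈ [m] being the Fin index i-1.
-- A set Z of triples is given by its (Boolean) membership function.

Rel3 : ℕ → Set
Rel3 m = Fin m → Fin m → Fin m → Bool

Has : ∀ {m} → Rel3 m → Fin m → Fin m → Fin m → Set
Has Z x y z = T (Z x y z)

Distinct3 : ∀ {m} → Fin m → Fin m → Fin m → Set
Distinct3 x y z = (x ≢ y) × (y ≢ z) × (x ≢ z)

IsTotalCyclicOrder : ∀ {m} → Rel3 m → Set
IsTotalCyclicOrder Z =
    (∀ x y z → Has Z x y z → Distinct3 x y z)
  × (∀ x y z → Has Z x y z → Has Z y z x)
  × (∀ x y z → Has Z x y z → ¬ Has Z z y x)
  × (∀ x y z u → Has Z x y z → Has Z x z u → Has Z x y u)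
  × (∀ x y z → Distinct3 x y z → Has Z x y z ⊎ Has Z z y x)

SignCond : ∀ {m} → Sign → Rel3 m → Fin m → Fin m → Fin m → Set
SignCond ⊕ Z a b c = Has Z a b c
SignCond ⊖ Z a b c = Has Z c b a

-- Z ∈ 𝒫_w  for w ∈ {+,-}^n, m = n+2; position p : Fin n of w is i = p+1.
InP : ∀ {n} → Vec Sign n → Rel3 (suc (suc n)) → Set
InP {n} w Z = ∀ (p : Fin n) →
  SignCond (lookup w p) Z (inject₁ (inject₁ p)) (inject₁ (suc p)) (suc (suc p))

-- the elements 1, m-1, m of [m] (m = n+2)
one : ∀ {n} → Fin (suc (suc n))
one = zero

mm1 : ∀ {n} → Fin (suc (suc n))
mm1 {n} = inject₁ (fromℕ n)

mm : ∀ {n} → Fin (suc (suc n))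
mm {n} = fromℕ (suc n)

cZ : ∀ {m} → Rel3 m → Fin m → Fin m → ℕ
cZ {m} Z a b = length (filter (λ x → T? (Z a x b)) (allFin m))

consF : ∀ {B : Set} {n} → B → (Fin n → B) → Fin (suc n) → B
consF b f zero = b
consF b f (suc i) = f i

allFunsOver : ∀ {B : Set} → List B → (n : ℕ) → List (Fin n → B)
allFunsOver bs zero = (λ ()) ∷ [] 
allFunsOver bs (suc n) = concatMap (λ b → map (consF b) (allFunsOver bs n)) bs

allRel3 : (m : ℕ) → List (Rel3 m)
allRel3 m = allFunsOver (allFunsOver (allFunsOver (true ∷ false ∷ []) m) m) m

countDec : ∀ {A : Set} {P : A → Set} → (∀ a → Dec (P a)) → List A → ℕ
countDec P? xs = length (filter P? xs)

Has? : ∀ {m} (Z : Rel3 m) x y z → Dec (Has Z x y z)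
Has? Z x y z = T? (Z x y z)

Distinct3? : ∀ {m} (x y z : Fin m) → Dec (Distinct3 x y z)
Distinct3? x y z = ¬? (x ≟F y) ×-dec ¬? (y ≟F z) ×-dec ¬? (x ≟F z)

IsTotalCyclicOrder? : ∀ {m} (Z : Rel3 m) → Dec (IsTotalCyclicOrder Z)
IsTotalCyclicOrder? Z =
      all? (λ x → all? (λ y → all? (λ z → Has? Z x y z →-dec Distinct3? x y z)))
  ×-dec all? (λ x → all? (λ y → all? (λ z → Has? Z x y z →-dec Has? Z y z x)))
  ×-dec all? (λ x → all? (λ y → all? (λ z → Has? Z x y z →-dec ¬? (Has? Z z y x))))
  ×-dec all? (λ x → all? (λ y → all? (λ z → all? (λ u →
          Has? Z x y z →-dec (Has? Z x z u →-dec Has? Z x y u)))))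
  ×-dec all? (λ x → all? (λ y → all? (λ z →
          Distinct3? x y z →-dec (Has? Z x y z ⊎-dec Has? Z z y x))))

SignCond? : ∀ {m} s (Z : Rel3 m) a b c → Dec (SignCond s Z a b c)
SignCond? ⊕ Z a b c = Has? Z a b c
SignCond? ⊖ Z a b c = Has? Z c b a

InP? : ∀ {n} (w : Vec Sign n) Z → Dec (InP w Z)
InP? w Z = all? (λ p → SignCond? (lookup w p) Z _ _ _)

Cond⁺ : ∀ {n} → Vec Sign n → ℕ → ℕ → ℕ → Rel3 (suc (suc n)) → Set
Cond⁺ w i j k Z =
  IsTotalCyclicOrder Z × InP w Z × Has Z mm1 mm one
  × cZ Z mm1 mm ≡ i × cZ Z mm one ≡ j × cZ Z one mm1 ≡ k

Cond⁻ : ∀ {n} → Vec Sign n → ℕ → ℕ → ℕ → Rel3 (suc (suc n)) → Set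
Cond⁻ w i j k Z =
  IsTotalCyclicOrder Z × InP w Z × Has Z one mm mm1
  × cZ Z mm mm1 ≡ i × cZ Z mm1 one ≡ j × cZ Z one mm ≡ k

Cond⁺? : ∀ {n} (w : Vec Sign n) i j k Z → Dec (Cond⁺ w i j k Z)
Cond⁺? w i j k Z = IsTotalCyclicOrder? Z ×-dec InP? w Z ×-dec Has? Z _ _ _
  ×-dec (cZ Z mm1 mm ≟ i) ×-dec (cZ Z mm one ≟ j) ×-dec (cZ Z one mm1 ≟ k)

Cond⁻? : ∀ {n} (w : Vec Sign n) i j k Z → Dec (Cond⁻ w i j k Z)
Cond⁻? w i j k Z = IsTotalCyclicOrder? Z ×-dec InP? w Z ×-dec Has? Z _ _ _
  ×-dec (cZ Z mm mm1 ≟ i) ×-dec (cZ Z mm1 one ≟ j) ×-dec (cZ Z one mm ≟ k)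

f⁺ : ∀ {n} → Vec Sign n → ℕ → ℕ → ℕ → ℕ
f⁺ {n} w i j k = countDec (Cond⁺? w i j k) (allRel3 (suc (suc n)))

f⁻ : ∀ {n} → Vec Sign n → ℕ → ℕ → ℕ → ℕ
f⁻ {n} w i j k = countDec (Cond⁻? w i j k) (allRel3 (suc (suc n)))

-- Polynomials in ℤ[X₁,X₂,X₃] as finite lists of terms (coefficient, exponent vector);
-- a list denotes the sum of its terms; equality is equality of all coefficients.

Mono : Set
Mono = Fin 3 → ℕ

Poly : Set
Poly = List (ℤ × Mono)

x₁ x₂ x₃ : Fin 3
x₁ = zero
x₂ = suc zero
x₃ = suc (suc zero)

mono3 : ℕ → ℕ → ℕ → Mono
mono3 i j k zero = i
mono3 i j k (suc zero) = j
mono3 i j k (suc (suc zero)) = k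

coeff : Poly → ℕ → ℕ → ℕ → ℤ
coeff P i j k = foldr (λ t acc → term t +ℤ acc) (+ 0) P
  where
  term : ℤ × Mono → ℤ
  term (c , e) = if ⌊ e x₁ ≟ i ⌋ then (if ⌊ e x₂ ≟ j ⌋ then (if ⌊ e x₃ ≟ k ⌋ then c else + 0) else + 0) else + 0

_≈P_ : Poly → Poly → Set
P ≈P R = ∀ i j k → coeff P i j k ≡ coeff R i j k

_⊞_ : Poly → Poly → Poly
P ⊞ R = P ++ R

QPoly : ∀ {n} → (ℕ → ℕ → ℕ → ℕ) → Poly
QPoly {n} f =
  concatMap (λ i → map (λ j → (+ f i j (N ∸ i ∸ j)) , mono3 i j (N ∸ i ∸ j))
                       (upTo (suc (N ∸ i))))
            (upTo (suc N))
  where N = n ∸ 1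

Q⁺ : ∀ {n} → Vec Sign n → Poly
Q⁺ {n} w = QPoly {n} (f⁺ w)

Q⁻ : ∀ {n} → Vec Sign n → Poly
Q⁻ {n} w = QPoly {n} (f⁻ w)

-- Φ_{a,b,c} (b ≠ c), linear, on the monomial with exponents e:
-- (∏_{ℓ∉{b,c}} X_ℓ^{e_ℓ}) X_a^{e_b+1} Σ_{k=0}^{e_c} X_b^{e_c-k} X_c^k
Φmono : Fin 3 → Fin 3 → Fin 3 → Mono → ℕ → Mono
Φmono a b c e k ℓ =
    (if ⌊ ℓ ≟F b ⌋ ∨ ⌊ ℓ ≟F c ⌋ then 0 else e ℓ)
  + (if ⌊ ℓ ≟F a ⌋ then suc (e b) else 0)
  + (if ⌊ ℓ ≟F b ⌋ then e c ∸ k else 0)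
  + (if ⌊ ℓ ≟F c ⌋ then k else 0)

Φ : (a b c : Fin 3) → b ≢ c → Poly → Poly
Φ a b c _ P = concatMap (λ t → Φterm t) P
  where
  Φterm : ℤ × Mono → Poly
  Φterm (coef , e) = map (λ k → coef , Φmono a b c e k) (upTo (suc (e c)))

module Submission where

-- Fix the element 1 as origin. A total cyclic order Z on [m] is then the same as a bijection
-- from [m] to the positions {0, …, m-1} sending 1 to 0, such that (x, y, z) ∈ Z exactly
-- when the positions of x, y, z are cyclically increasing; c_Z(a, b) counts the positions strictly
-- between those of a and b, going round.
-- Deleting m+1 from an order in 𝒬^η_{wε} leaves an order in 𝒬^η′_w, and the order is recovered from
-- the deleted one and the position s at which m+1 is put back. In each of the six cases (η, ε, η′)
-- the admissible s are indexed by k ≤ e_c, where e is the gap vector c̃ of the deleted order, and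
-- inserting at the k-th of them yields the exponent vector of the k-th monomial of Φ_{a,b,c}(X^e).
-- For Q^-_{w+} and Q^+_{w-} the class η′ of the deleted order is forced; for the other two both classes
-- occur and give the two summands. Coefficients are compared as lengths of duplicate-free lists that
-- enumerate the same orders up to pointwise equality.

open import Defs
open import Data.Nat using (ℕ; zero; suc; _+_; _≟_; _∸_; _≤_; _<_; _<?_; _<ᵇ_; _≡ᵇ_; z≤n; s≤s; z<s; pred)
open import Data.Nat.Properties
open import Data.Bool using (Bool; true; false; T; _∧_; _∨_; not; if_then_else_)
open import Data.Bool.Properties using (T-≡; T-∧; T-∨; T-not-≡)
open import Data.Fin using (Fin; zero; suc; inject₁; fromℕ) renaming (_≟_ to _≟F_)
import Data.Fin.Properties as Fin
open import Data.Fin.Properties using (fromℕ≢inject₁; inject₁-injective)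

open import Data.Fin.Relation.Unary.Top using (view; ‵fromℕ; ‵inject₁)
open import Data.Vec using (Vec; []; _∷_; lookup; _∷ʳ_)
open import Data.List using (List; []; _∷_; _++_; map; concatMap; filter; length; upTo; tabulate)
open import Data.List.Relation.Unary.Any as Any using (Any; here; there)
open import Data.List.Relation.Unary.All as All using (All; []; _∷_)
open import Data.List.Relation.Unary.AllPairs as AllPairs using (AllPairs; []; _∷_)
import Data.List.Relation.Unary.Any.Properties as Any
import Data.List.Relation.Unary.All.Properties as All
import Data.List.Relation.Unary.AllPairs.Properties as AllPairs
import Data.List.Properties as List
open import Data.List.Relation.Unary.Unique.Propositional.Properties using (upTo⁺)
open import Data.Integer using (ℤ) renaming (_+_ to _+ℤ_)
import Data.Integer as ℤ using (+_)
import Data.Integer.Properties as ℤₚ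
open import Data.Product using (_×_; _,_; proj₁; proj₂; ∃)
open import Data.Sum using (_⊎_; inj₁; inj₂; [_,_]′)
open import Data.Empty using (⊥; ⊥-elim)
open import Data.Unit using (tt)
open import Data.Nat.Tactic.RingSolver using (solve-∀)
open import Function using (_∘_; _$_; Equivalence; Injective)
open import Relation.Binary using (tri<; tri≈; tri>; Setoid)
open import Relation.Unary using (Decidable)
open import Level using (0ℓ)
open import Relation.Binary.PropositionalEquality
open import Relation.Nullary using (¬_; Dec; yes; no)
open import Relation.Nullary.Decidable using (T?; ⌊_⌋; toWitness; fromWitness; _×-dec_; _⊎-dec_)

open Equivalence using (to; from)

count : ∀ n → (Fin n → Bool) → ℕ
count zero    f = 0
count (suc n) f = (if f zero then 1 else 0) + count n (f ∘ suc)

T-injective : ∀ {a b : Bool} → (T a → T b) → (T b → T a) → a ≡ b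
T-injective {false} {false} _ _ = refl
T-injective {false} {true}  _ g = ⊥-elim (g tt)
T-injective {true}  {false} f _ = ⊥-elim (f tt)
T-injective {true}  {true}  _ _ = refl

¬T⇒≡false : ∀ {a : Bool} → ¬ T a → a ≡ false
¬T⇒≡false {false} _ = refl
¬T⇒≡false {true}  n = ⊥-elim (n tt)

count-cong : ∀ n {f g : Fin n → Bool} → (∀ x → f x ≡ g x) → count n f ≡ count n g
count-cong zero    e = refl
count-cong (suc n) e = cong₂ _+_ (cong (λ b → if b then 1 else 0) (e zero)) (count-cong n (e ∘ suc))

length-filter-tabulate : ∀ {A : Set} n (g : A → Bool) (h : Fin n → A) →
  length (filter (λ x → T? (g x)) (tabulate h)) ≡ count n (g ∘ h)
length-filter-tabulate zero    g h = refl
length-filter-tabulate (suc n) g h with g (h zero)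
... | true  = cong suc (length-filter-tabulate n g (h ∘ suc))
... | false = length-filter-tabulate n g (h ∘ suc)

count-false : ∀ n (f : Fin n → Bool) → (∀ x → f x ≡ false) → count n f ≡ 0
count-false zero    f e = refl
count-false (suc n) f e rewrite e zero = count-false n (f ∘ suc) (e ∘ suc)

count-true : ∀ n (f : Fin n → Bool) → (∀ x → T (f x)) → count n f ≡ n
count-true zero    f h = refl
count-true (suc n) f h with f zero | h zero
... | true | _ = cong suc (count-true n (f ∘ suc) (h ∘ suc))

count-mono : ∀ n (f g : Fin n → Bool) → (∀ x → T (f x) → T (g x)) → count n f ≤ count n g
count-mono zero    f g i = z≤n
count-mono (suc n) f g i with f zero in ef | g zero in eg
... | true  | true  = s≤s (count-mono n _ _ (i ∘ suc))
... | false | true  = m≤n⇒m≤1+n (count-mono n _ _ (i ∘ suc))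
... | false | false = count-mono n _ _ (i ∘ suc)
... | true  | false = ⊥-elim (subst T eg (i zero (subst T (sym ef) tt)))

count-strict : ∀ n (f g : Fin n → Bool) → (∀ x → T (f x) → T (g x)) →
  (a : Fin n) → T (g a) → ¬ T (f a) → count n f < count n g
count-strict (suc n) f g i zero ga nfa with f zero in ef | g zero in eg
... | true  | _     = ⊥-elim (nfa tt)
... | false | false = ⊥-elim ga
... | false | true  = s≤s (count-mono n _ _ (i ∘ suc))
count-strict (suc n) f g i (suc a) ga nfa with f zero in ef | g zero in eg
... | true  | true  = s≤s (count-strict n _ _ (i ∘ suc) a ga nfa)
... | false | true  = m<n⇒m<1+n (count-strict n _ _ (i ∘ suc) a ga nfa)
... | false | false = count-strict n _ _ (i ∘ suc) a ga nfa
... | true  | false = ⊥-elim (subst T eg (i zero (subst T (sym ef) tt)))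

count-split : ∀ n (f g : Fin n → Bool) →
  count n f ≡ count n (λ x → f x ∧ g x) + count n (λ x → f x ∧ not (g x))
count-split zero    f g = refl
count-split (suc n) f g with f zero | g zero
... | true  | true  = cong suc (count-split n _ _)
... | true  | false = trans (cong suc (count-split n _ _)) (sym (+-suc _ _))
... | false | true  = count-split n _ _
... | false | false = count-split n _ _

count-not : ∀ n (f : Fin n → Bool) → count n f + count n (not ∘ f) ≡ n
count-not zero    f = refl
count-not (suc n) f with f zero
... | true  = cong suc (count-not n _)
... | false = trans (+-suc _ _) (cong suc (count-not n _))

count-∨-disjoint : ∀ n (f g : Fin n → Bool) → (∀ x → T (f x) → T (g x) → ⊥) →
  count n (λ x → f x ∨ g x) ≡ count n f + count n g
count-∨-disjoint zero    f g d = refl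
count-∨-disjoint (suc n) f g d with f zero in ef | g zero in eg
... | true  | true  = ⊥-elim (d zero (subst T (sym ef) tt) (subst T (sym eg) tt))
... | true  | false = cong suc (count-∨-disjoint n _ _ (d ∘ suc))
... | false | true  = trans (cong suc (count-∨-disjoint n _ _ (d ∘ suc))) (sym (+-suc _ _))
... | false | false = count-∨-disjoint n _ _ (d ∘ suc)

count-≤1 : ∀ n (f : Fin n → Bool) → (∀ x y → T (f x) → T (f y) → x ≡ y) → count n f ≤ 1
count-≤1 zero    f u = z≤n
count-≤1 (suc n) f u with f zero in e
... | true  = ≤-reflexive (cong suc (count-false n _ (λ x →
  ¬T⇒≡false (λ h → Fin.0≢1+n (u zero (suc x) (subst T (sym e) tt) h)))))
... | false = count-≤1 n _ (λ x y hx hy → Fin.suc-injective (u (suc x) (suc y) hx hy))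

Cyclic : ℕ → ℕ → ℕ → Set
Cyclic a b c = (a < b × b < c) ⊎ (b < c × c < a) ⊎ (c < a × a < b)

cyclic? : ∀ a b c → Dec (Cyclic a b c)
cyclic? a b c = (a <? b ×-dec b <? c) ⊎-dec (b <? c ×-dec c <? a) ⊎-dec (c <? a ×-dec a <? b)

cyclicᵇ : ℕ → ℕ → ℕ → Bool
cyclicᵇ a b c = ⌊ cyclic? a b c ⌋

toCyclic : ∀ {a b c} → T (cyclicᵇ a b c) → Cyclic a b c
toCyclic {a} {b} {c} = toWitness {a? = cyclic? a b c}

fromCyclic : ∀ {a b c} → Cyclic a b c → T (cyclicᵇ a b c)
fromCyclic {a} {b} {c} = fromWitness {a? = cyclic? a b c}

Cyclic-rotate : ∀ {a b c} → Cyclic a b c → Cyclic b c a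
Cyclic-rotate (inj₁ x)        = inj₂ (inj₂ x)
Cyclic-rotate (inj₂ (inj₁ x)) = inj₁ x
Cyclic-rotate (inj₂ (inj₂ x)) = inj₂ (inj₁ x)

Cyclic-asym : ∀ {a b c} → Cyclic a b c → ¬ Cyclic c b a
Cyclic-asym (inj₁ (p , q))        (inj₁ (r , s))        = <-asym q r
Cyclic-asym (inj₁ (p , q))        (inj₂ (inj₁ (r , s))) = <-asym p r
Cyclic-asym (inj₁ (p , q))        (inj₂ (inj₂ (r , s))) = <-asym q s
Cyclic-asym (inj₂ (inj₁ (p , q))) (inj₁ (r , s))        = <-asym p r
Cyclic-asym (inj₂ (inj₁ (p , q))) (inj₂ (inj₁ (r , s))) = <-asym q s
Cyclic-asym (inj₂ (inj₁ (p , q))) (inj₂ (inj₂ (r , s))) = <-asym p s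
Cyclic-asym (inj₂ (inj₂ (p , q))) (inj₁ (r , s))        = <-asym q s
Cyclic-asym (inj₂ (inj₂ (p , q))) (inj₂ (inj₁ (r , s))) = <-asym q r
Cyclic-asym (inj₂ (inj₂ (p , q))) (inj₂ (inj₂ (r , s))) = <-asym p r

Cyclic-trans : ∀ {a b c d} → Cyclic a b c → Cyclic a c d → Cyclic a b d
Cyclic-trans (inj₁ (p , q))        (inj₁ (r , s))        = inj₁ (p , <-trans q s)
Cyclic-trans (inj₁ (p , q))        (inj₂ (inj₁ (r , s))) = ⊥-elim (<-asym (<-trans p q) (<-trans r s))
Cyclic-trans (inj₁ (p , q))        (inj₂ (inj₂ (r , s))) = inj₂ (inj₂ (r , p))
Cyclic-trans (inj₂ (inj₁ (p , q))) (inj₁ (r , s))        = ⊥-elim (<-asym q r)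
Cyclic-trans (inj₂ (inj₁ (p , q))) (inj₂ (inj₁ (r , s))) = inj₂ (inj₁ (<-trans p r , s))
Cyclic-trans (inj₂ (inj₁ (p , q))) (inj₂ (inj₂ (r , s))) = ⊥-elim (<-asym q s)
Cyclic-trans (inj₂ (inj₂ (p , q))) (inj₁ (r , s))        = ⊥-elim (<-asym p r)
Cyclic-trans (inj₂ (inj₂ (p , q))) (inj₂ (inj₁ (r , s))) = inj₂ (inj₂ (s , q))
Cyclic-trans (inj₂ (inj₂ (p , q))) (inj₂ (inj₂ (r , s))) = ⊥-elim (<-asym p s)

Cyclic-total : ∀ {a b c} → a ≢ b → b ≢ c → a ≢ c → Cyclic a b c ⊎ Cyclic c b a
Cyclic-total {a} {b} {c} ab bc ac with <-cmp a b | <-cmp b c | <-cmp a c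
... | tri≈ _ e _ | _          | _          = ⊥-elim (ab e)
... | _          | tri≈ _ e _ | _          = ⊥-elim (bc e)
... | _          | _          | tri≈ _ e _ = ⊥-elim (ac e)
... | tri< p _ _ | tri< q _ _ | _          = inj₁ (inj₁ (p , q))
... | tri< p _ _ | tri> _ _ q | tri< r _ _ = inj₂ (inj₂ (inj₂ (r , q)))
... | tri< p _ _ | tri> _ _ q | tri> _ _ r = inj₁ (inj₂ (inj₂ (r , p)))
... | tri> _ _ p | tri< q _ _ | tri< r _ _ = inj₂ (inj₂ (inj₁ (p , r)))
... | tri> _ _ p | tri< q _ _ | tri> _ _ r = inj₁ (inj₂ (inj₁ (q , r)))
... | tri> _ _ p | tri> _ _ q | _          = inj₂ (inj₁ (q , p))

Cyclic-map : ∀ {a b c a′ b′ c′} → (a < b → a′ < b′) → (b < c → b′ < c′) → (c < a → c′ < a′) →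
  Cyclic a b c → Cyclic a′ b′ c′
Cyclic-map f g h (inj₁ (p , q))        = inj₁ (f p , g q)
Cyclic-map f g h (inj₂ (inj₁ (p , q))) = inj₂ (inj₁ (g p , h q))
Cyclic-map f g h (inj₂ (inj₂ (p , q))) = inj₂ (inj₂ (h p , f q))

Cyclic-distinct : ∀ {a b c} → Cyclic a b c → a ≢ b × b ≢ c × a ≢ c
Cyclic-distinct (inj₁ (p , q))        = <⇒≢ p , <⇒≢ q , <⇒≢ (<-trans p q)
Cyclic-distinct (inj₂ (inj₁ (p , q))) = ≢-sym (<⇒≢ (<-trans p q)) , <⇒≢ p , ≢-sym (<⇒≢ q)
Cyclic-distinct (inj₂ (inj₂ (p , q))) = <⇒≢ q , ≢-sym (<⇒≢ (<-trans p q)) , ≢-sym (<⇒≢ p)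

-- Total cyclic orders and position functions

orderBy : ∀ {M} → (Fin M → ℕ) → Rel3 M
orderBy q x y z = cyclicᵇ (q x) (q y) (q z)

orderBy-isTotalCyclicOrder : ∀ {M} (q : Fin M → ℕ) → Injective _≡_ _≡_ q → IsTotalCyclicOrder (orderBy q)
orderBy-isTotalCyclicOrder q inj = distinct , rotate , asym , trans′ , total
  where
  distinct : ∀ x y z → Has (orderBy q) x y z → Distinct3 x y z
  distinct x y z h with Cyclic-distinct (toCyclic h)
  ... | e1 , e2 , e3 = (λ e → e1 (cong q e)) , (λ e → e2 (cong q e)) , (λ e → e3 (cong q e))
  rotate : ∀ x y z → Has (orderBy q) x y z → Has (orderBy q) y z x
  rotate x y z h = fromCyclic (Cyclic-rotate (toCyclic h))
  asym : ∀ x y z → Has (orderBy q) x y z → ¬ Has (orderBy q) z y x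
  asym x y z h h' = Cyclic-asym (toCyclic h) (toCyclic h')
  trans′ : ∀ x y z u → Has (orderBy q) x y z → Has (orderBy q) x z u → Has (orderBy q) x y u
  trans′ x y z u h h' = fromCyclic (Cyclic-trans (toCyclic h) (toCyclic h'))
  total : ∀ x y z → Distinct3 x y z → Has (orderBy q) x y z ⊎ Has (orderBy q) z y x
  total x y z (e1 , e2 , e3) with Cyclic-total (e1 ∘ inj) (e2 ∘ inj) (e3 ∘ inj)
  ... | inj₁ h = inj₁ (fromCyclic h)
  ... | inj₂ h = inj₂ (fromCyclic h)

position : ∀ {M} → Rel3 (suc M) → Fin (suc M) → ℕ
position Z zero    = 0
position {M} Z (suc y) = suc (count (suc M) (λ x → Z zero x (suc y)))

module TotalCyclicOrder {M : ℕ} (Z : Rel3 (suc M)) (tco : IsTotalCyclicOrder Z) where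

  distinct : ∀ x y z → Has Z x y z → Distinct3 x y z
  distinct = proj₁ tco

  rotate : ∀ x y z → Has Z x y z → Has Z y z x
  rotate = proj₁ (proj₂ tco)

  asym : ∀ x y z → Has Z x y z → ¬ Has Z z y x
  asym = proj₁ (proj₂ (proj₂ tco))

  transitive : ∀ x y z u → Has Z x y z → Has Z x z u → Has Z x y u
  transitive = proj₁ (proj₂ (proj₂ (proj₂ tco)))

  total : ∀ x y z → Distinct3 x y z → Has Z x y z ⊎ Has Z z y x
  total = proj₂ (proj₂ (proj₂ (proj₂ tco)))

  rotate² : ∀ {x y z} → Has Z x y z → Has Z z x y
  rotate² h = rotate _ _ _ (rotate _ _ _ h)

  before : Fin (suc M) → ℕ
  before y = count (suc M) (λ x → Z zero x y)

  before-mono : ∀ a b → Has Z zero a b → before a < before b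
  before-mono a b h = count-strict (suc M) _ _ (λ y hy → transitive zero y a b hy h) a h
                        (λ h' → proj₁ (proj₂ (distinct _ _ _ h')) refl)

  between : ∀ a b c → Has Z zero a b → Has Z zero b c → Has Z a b c
  between a b c h1 h2
    with total a b c (proj₁ (proj₂ (distinct _ _ _ h1)) , proj₁ (proj₂ (distinct _ _ _ h2)) ,
                      proj₁ (proj₂ (distinct _ _ _ (transitive _ _ _ _ h1 h2))))
  ... | inj₁ h = h
  ... | inj₂ h = ⊥-elim (asym _ _ _ h1 (transitive b a c zero (rotate _ _ _ h) (rotate _ _ _ h2)))

  Has-zero-total : ∀ a b → a ≢ b → Has Z zero (suc a) (suc b) ⊎ Has Z zero (suc b) (suc a)
  Has-zero-total a b a≢b with total zero (suc a) (suc b) ((λ ()) , a≢b ∘ Fin.suc-injective , (λ ()))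
  ... | inj₁ h = inj₁ h
  ... | inj₂ h = inj₂ (rotate² h)

  before-reflects : ∀ a b → before (suc a) < before (suc b) → Has Z zero (suc a) (suc b)
  before-reflects a b lt with a ≟F b
  ... | yes refl = ⊥-elim (<-irrefl refl lt)
  ... | no a≢b with Has-zero-total a b a≢b
  ... | inj₁ h = h
  ... | inj₂ h = ⊥-elim (<-asym lt (before-mono _ _ h))

  position-injective : Injective _≡_ _≡_ (position Z)
  position-injective {zero}  {zero}  e = refl
  position-injective {suc a} {suc b} e with a ≟F b
  ... | yes refl = refl
  ... | no a≢b with Has-zero-total a b a≢b
  ... | inj₁ h = ⊥-elim (<-irrefl (suc-injective e) (before-mono _ _ h))
  ... | inj₂ h = ⊥-elim (<-irrefl (sym (suc-injective e)) (before-mono _ _ h))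

  position-< : ∀ x → position Z x < suc M
  position-< zero    = s≤s z≤n
  position-< (suc x) rewrite ¬T⇒≡false {Z zero zero (suc x)} (λ h → proj₁ (distinct _ _ _ h) refl) =
    s≤s (subst (count M (λ y → Z zero (suc y) (suc x)) <_) (count-true M _ (λ _ → tt))
          (count-strict M _ (λ _ → true) (λ _ _ → tt) x tt (λ h → proj₁ (proj₂ (distinct _ _ _ h)) refl)))

  private
    has-from-zero : ∀ y z → Cyclic 0 (position Z y) (position Z z) → Has Z zero y z
    has-from-zero zero    z       c = ⊥-elim (proj₁ (Cyclic-distinct c) refl)
    has-from-zero (suc y) zero    c = ⊥-elim (proj₂ (proj₂ (Cyclic-distinct c)) refl)
    has-from-zero (suc y) (suc z) (inj₁ (_ , q)) = before-reflects y z (≤-pred q)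
    has-from-zero (suc y) (suc z) (inj₂ (inj₁ (_ , ())))
    has-from-zero (suc y) (suc z) (inj₂ (inj₂ (() , _)))

    has-from-position : ∀ x y z → Cyclic (position Z x) (position Z y) (position Z z) → Has Z x y z
    has-from-position zero y z c = has-from-zero y z c
    has-from-position (suc x) zero z c = rotate² (has-from-zero z (suc x) (Cyclic-rotate c))
    has-from-position (suc x) (suc y) zero c =
      rotate _ _ _ (has-from-zero (suc x) (suc y) (Cyclic-rotate (Cyclic-rotate c)))
    has-from-position (suc x) (suc y) (suc z) (inj₁ (p , q)) =
      between _ _ _ (before-reflects x y (≤-pred p)) (before-reflects y z (≤-pred q))
    has-from-position (suc x) (suc y) (suc z) (inj₂ (inj₁ (p , q))) =
      rotate² (between _ _ _ (before-reflects y z (≤-pred p)) (before-reflects z x (≤-pred q)))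
    has-from-position (suc x) (suc y) (suc z) (inj₂ (inj₂ (p , q))) =
      rotate _ _ _ (between _ _ _ (before-reflects z x (≤-pred p)) (before-reflects x y (≤-pred q)))

  ≡orderBy-position : ∀ x y z → Z x y z ≡ orderBy (position Z) x y z
  ≡orderBy-position x y z = T-injective to′ (has-from-position x y z ∘ toCyclic)
    where
    to′ : Has Z x y z → T (orderBy (position Z) x y z)
    to′ h with distinct _ _ _ h
    ... | e1 , e2 , e3
      with Cyclic-total (e1 ∘ position-injective) (e2 ∘ position-injective) (e3 ∘ position-injective)
    ... | inj₁ c = fromCyclic c
    ... | inj₂ c = ⊥-elim (asym _ _ _ h (has-from-position z y x c))

IsPermutation : ∀ {M} → (Fin M → ℕ) → Set
IsPermutation {M} p = Injective _≡_ _≡_ p × (∀ x → p x < M)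

<ᵇ-suc : ∀ v s → (v <ᵇ suc s) ≡ ((v <ᵇ s) ∨ (v ≡ᵇ s))
<ᵇ-suc zero    zero    = refl
<ᵇ-suc zero    (suc s) = refl
<ᵇ-suc (suc v) zero    = refl
<ᵇ-suc (suc v) (suc s) = <ᵇ-suc v s

T-not : ∀ {b} → ¬ T b → T (not b)
T-not n = from T-not-≡ (¬T⇒≡false n)

T-not⁻ : ∀ {b} → T (not b) → ¬ T b
T-not⁻ h t = subst T (to T-not-≡ h) t

module Permutation {M} (p : Fin M → ℕ) (perm : IsPermutation p) where

  below : ℕ → ℕ
  below s = count M (λ y → p y <ᵇ s)

  below-suc : ∀ s → below (suc s) ≤ suc (below s)
  below-suc s = begin
      below (suc s)
    ≡⟨ count-cong M (λ y → <ᵇ-suc (p y) s) ⟩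
      count M (λ y → (p y <ᵇ s) ∨ (p y ≡ᵇ s))
    ≡⟨ count-∨-disjoint M _ _ (λ y h1 h2 → <-irrefl (≡ᵇ⇒≡ (p y) s h2) (<ᵇ⇒< (p y) s h1)) ⟩
      below s + count M (λ y → p y ≡ᵇ s)
    ≤⟨ +-monoʳ-≤ (below s) (count-≤1 M _ (λ x y hx hy → proj₁ perm (trans (≡ᵇ⇒≡ _ _ hx) (sym (≡ᵇ⇒≡ _ _ hy))))) ⟩
      below s + 1
    ≡⟨ +-comm (below s) 1 ⟩
      suc (below s) ∎
    where open ≤-Reasoning

  below-+ : ∀ s d → below (s + d) ≤ below s + d
  below-+ s zero    rewrite +-identityʳ s | +-identityʳ (below s) = ≤-refl
  below-+ s (suc d) rewrite +-suc s d | +-suc (below s) d = ≤-trans (below-suc (s + d)) (s≤s (below-+ s d))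

  -- below 0 = 0 and below M = M, and below grows by at most one per step.
  below-exact : ∀ s → s ≤ M → below s ≡ s
  below-exact s s≤M = ≤-antisym upper lower
    where
    upper : below s ≤ s
    upper = subst (λ v → below s ≤ v + s) (count-false M _ (λ y → refl)) (below-+ 0 s)
    lower : s ≤ below s
    lower = +-cancelʳ-≤ (M ∸ s) s (below s) (begin
        s + (M ∸ s)         ≡⟨ m+[n∸m]≡n s≤M ⟩
        M                   ≡⟨ sym (count-true M _ (λ y → <⇒<ᵇ (proj₂ perm y))) ⟩
        below M             ≡⟨ cong below (sym (m+[n∸m]≡n s≤M)) ⟩
        below (s + (M ∸ s)) ≤⟨ below-+ s (M ∸ s) ⟩
        below s + (M ∸ s)   ∎)
      where open ≤-Reasoning

  gap : Fin M → Fin M → ℕ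
  gap a b = count M (λ x → orderBy p a x b)

  private
    inside-∧ : ∀ {u w} v → u < w → ((v <ᵇ w) ∧ (v <ᵇ suc u)) ≡ (v <ᵇ suc u)
    inside-∧ {u} {w} v u<w =
      T-injective (λ h → proj₂ (to T-∧ h)) (λ h → from T-∧ (<⇒<ᵇ (<-≤-trans (<ᵇ⇒< _ _ h) u<w) , h))

    cyclic-inside : ∀ {u w} v → u < w → cyclicᵇ u v w ≡ ((v <ᵇ w) ∧ not (v <ᵇ suc u))
    cyclic-inside {u} {w} v u<w = T-injective to′ from′
      where
      to′ : T (cyclicᵇ u v w) → T ((v <ᵇ w) ∧ not (v <ᵇ suc u))
      to′ h with toCyclic h
      ... | inj₁ (p1 , p2)        = from T-∧ (<⇒<ᵇ p2 , T-not (λ h' → <⇒≱ p1 (≤-pred (<ᵇ⇒< _ _ h'))))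
      ... | inj₂ (inj₁ (p1 , p2)) = ⊥-elim (<-asym u<w p2)
      ... | inj₂ (inj₂ (p1 , p2)) = ⊥-elim (<-asym u<w p1)
      from′ : T ((v <ᵇ w) ∧ not (v <ᵇ suc u)) → T (cyclicᵇ u v w)
      from′ h with to T-∧ h
      ... | h1 , h2 = fromCyclic (inj₁ (≮⇒≥ (λ q → T-not⁻ h2 (<⇒<ᵇ (s≤s q))) , <ᵇ⇒< _ _ h1))

    cyclic-outside : ∀ {u w} v → w < u → cyclicᵇ u v w ≡ ((v <ᵇ w) ∨ not (v <ᵇ suc u))
    cyclic-outside {u} {w} v w<u = T-injective to′ from′
      where
      to′ : T (cyclicᵇ u v w) → T ((v <ᵇ w) ∨ not (v <ᵇ suc u))
      to′ h with toCyclic h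
      ... | inj₁ (p1 , p2)        = ⊥-elim (<-asym w<u (<-trans p1 p2))
      ... | inj₂ (inj₁ (p1 , p2)) = from T-∨ (inj₁ (<⇒<ᵇ p1))
      ... | inj₂ (inj₂ (p1 , p2)) = from T-∨ (inj₂ (T-not (λ h' → <⇒≱ p2 (≤-pred (<ᵇ⇒< _ _ h')))))
      from′ : T ((v <ᵇ w) ∨ not (v <ᵇ suc u)) → T (cyclicᵇ u v w)
      from′ h with to T-∨ h
      ... | inj₁ h1 = fromCyclic (inj₂ (inj₁ (<ᵇ⇒< _ _ h1 , w<u)))
      ... | inj₂ h2 = fromCyclic (inj₂ (inj₂ (w<u , ≮⇒≥ (λ q → T-not⁻ h2 (<⇒<ᵇ (s≤s q))))))

    below-1+ : ∀ a → below (suc (p a)) ≡ suc (p a)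
    below-1+ a = below-exact _ (proj₂ perm a)

    below-at : ∀ b → below (p b) ≡ p b
    below-at b = below-exact _ (<⇒≤ (proj₂ perm b))

  -- c(a, b) = p b - p a - 1, stated without truncated subtraction
  gap-< : ∀ a b → p a < p b → gap a b + suc (p a) ≡ p b
  gap-< a b lt = begin
      gap a b + suc (p a)
    ≡⟨ +-comm (gap a b) _ ⟩
      suc (p a) + gap a b
    ≡⟨ cong₂ _+_ (trans (sym (below-1+ a)) (sym (count-cong M (λ x → inside-∧ (p x) lt))))
                 (count-cong M (λ x → cyclic-inside (p x) lt)) ⟩
      count M (λ x → (p x <ᵇ p b) ∧ (p x <ᵇ suc (p a))) + count M (λ x → (p x <ᵇ p b) ∧ not (p x <ᵇ suc (p a)))
    ≡⟨ sym (count-split M _ _) ⟩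
      below (p b)
    ≡⟨ below-at b ⟩
      p b ∎
    where open ≡-Reasoning

  gap-> : ∀ a b → p b < p a → gap a b + suc (p a) ≡ M + p b
  gap-> a b lt = begin
      gap a b + suc (p a)
    ≡⟨ cong₂ _+_ (trans (count-cong M (λ x → cyclic-outside (p x) lt))
                        (count-∨-disjoint M _ _ (λ x h1 h2 → T-not⁻ h2 (<⇒<ᵇ (<-trans (<ᵇ⇒< _ _ h1) (s≤s (<⇒≤ lt)))))))
                 (sym (below-1+ a)) ⟩
      (below (p b) + count M (λ x → not (p x <ᵇ suc (p a)))) + below (suc (p a))
    ≡⟨ +-assoc (below (p b)) _ _ ⟩
      below (p b) + (count M (λ x → not (p x <ᵇ suc (p a))) + below (suc (p a)))
    ≡⟨ cong₂ _+_ (below-at b) (trans (+-comm _ (below (suc (p a)))) (count-not M _)) ⟩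
      p b + M
    ≡⟨ +-comm (p b) M ⟩
      M + p b ∎
    where open ≡-Reasoning

position-orderBy : ∀ {M} (p : Fin (suc M) → ℕ) → IsPermutation p → p zero ≡ 0 →
  ∀ x → position (orderBy p) x ≡ p x
position-orderBy p perm p0 zero    = sym p0
position-orderBy p perm p0 (suc x) =
  trans (+-comm 1 _) (trans (cong (λ v → gap zero (suc x) + suc v) (sym p0)) (gap-< zero (suc x) p0<px))
  where
  open Permutation p perm
  p0<px : p zero < p (suc x)
  p0<px rewrite p0 = n≢0⇒n>0 (λ e → Fin.0≢1+n (sym (proj₁ perm (trans e (sym p0)))))

-- Inserting a new element at position s

punchOutℕ : ℕ → ℕ → ℕ
punchOutℕ s v = if v <ᵇ s then v else pred v

<ᵇ-true : ∀ {a b} → a < b → (a <ᵇ b) ≡ true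
<ᵇ-true p = to T-≡ (<⇒<ᵇ p)

<ᵇ-false : ∀ {a b} → b ≤ a → (a <ᵇ b) ≡ false
<ᵇ-false {a} {b} p = ¬T⇒≡false (λ q → <⇒≱ (<ᵇ⇒< a b q) p)

-- Opaque, so that unification treats punchInℕ s v as rigid; it is used only through the next two lemmas.
opaque
  punchInℕ : ℕ → ℕ → ℕ
  punchInℕ s v = if v <ᵇ s then v else suc v

  punchInℕ-< : ∀ {s v} → v < s → punchInℕ s v ≡ v
  punchInℕ-< p rewrite <ᵇ-true p = refl

  punchInℕ-≥ : ∀ {s v} → s ≤ v → punchInℕ s v ≡ suc v
  punchInℕ-≥ p rewrite <ᵇ-false p = refl

punchOutℕ-< : ∀ {s v} → v < s → punchOutℕ s v ≡ v
punchOutℕ-< p rewrite <ᵇ-true p = refl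

punchOutℕ-≥ : ∀ {s v} → s ≤ v → punchOutℕ s v ≡ pred v
punchOutℕ-≥ p rewrite <ᵇ-false p = refl

punchOutℕ-0 : ∀ s → punchOutℕ s 0 ≡ 0
punchOutℕ-0 s with 0 <ᵇ s
... | true  = refl
... | false = refl

punchInℕ-≢ : ∀ s v → punchInℕ s v ≢ s
punchInℕ-≢ s v e with v <? s
... | yes p rewrite punchInℕ-< p = <-irrefl e p
... | no p rewrite punchInℕ-≥ (≮⇒≥ p) = <-irrefl (sym e) (s≤s (≮⇒≥ p))

punchInℕ-mono-< : ∀ s {u v} → u < v → punchInℕ s u < punchInℕ s v
punchInℕ-mono-< s {u} {v} u<v with u <? s | v <? s
... | yes p | yes q rewrite punchInℕ-< p | punchInℕ-< q = u<v
... | yes p | no q  rewrite punchInℕ-< p | punchInℕ-≥ (≮⇒≥ q) = m<n⇒m<1+n u<v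
... | no p  | yes q = ⊥-elim (p (<-trans u<v q))
... | no p  | no q  rewrite punchInℕ-≥ (≮⇒≥ p) | punchInℕ-≥ (≮⇒≥ q) = s≤s u<v

punchInℕ-cancel-< : ∀ s {u v} → punchInℕ s u < punchInℕ s v → u < v
punchInℕ-cancel-< s {u} {v} lt with <-cmp u v
... | tri< u<v _ _ = u<v
... | tri≈ _ refl _ = ⊥-elim (<-irrefl refl lt)
... | tri> _ _ v<u = ⊥-elim (<-asym lt (punchInℕ-mono-< s v<u))

punchInℕ-injective : ∀ s → Injective _≡_ _≡_ (punchInℕ s)
punchInℕ-injective s {u} {v} e with <-cmp u v
... | tri< u<v _ _ = ⊥-elim (<-irrefl e (punchInℕ-mono-< s u<v))
... | tri≈ _ u≡v _ = u≡v
... | tri> _ _ v<u = ⊥-elim (<-irrefl (sym e) (punchInℕ-mono-< s v<u))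

punchInℕ-punchOutℕ : ∀ s v → v ≢ s → punchInℕ s (punchOutℕ s v) ≡ v
punchInℕ-punchOutℕ s v v≢s with v <? s
... | yes p rewrite punchOutℕ-< p = punchInℕ-< p
punchInℕ-punchOutℕ s zero    v≢s | no p = ⊥-elim (v≢s (sym (n≤0⇒n≡0 (≮⇒≥ p))))
punchInℕ-punchOutℕ s (suc v) v≢s | no p rewrite punchOutℕ-≥ (≮⇒≥ p) =
  punchInℕ-≥ (≤-pred (≤∧≢⇒< (≮⇒≥ p) (≢-sym v≢s)))

punchInℕ-<-inv : ∀ {s b} → punchInℕ s b < s → b < s × punchInℕ s b ≡ b
punchInℕ-<-inv {s} {b} lt with b <? s
... | yes p = p , punchInℕ-< p
... | no p = ⊥-elim (<-irrefl refl (≤-trans (subst (_< s) (punchInℕ-≥ (≮⇒≥ p)) lt) (≤-trans (≮⇒≥ p) (n≤1+n b))))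

punchInℕ->-inv : ∀ {s b} → s < punchInℕ s b → s ≤ b × punchInℕ s b ≡ suc b
punchInℕ->-inv {s} {b} lt with b <? s
... | yes p = ⊥-elim (<-asym p (subst (s <_) (punchInℕ-< p) lt))
... | no p = ≮⇒≥ p , punchInℕ-≥ (≮⇒≥ p)

≤-punchInℕ : ∀ s v → v ≤ punchInℕ s v
≤-punchInℕ s v with v <? s
... | yes p rewrite punchInℕ-< p = ≤-refl
... | no p rewrite punchInℕ-≥ (≮⇒≥ p) = n≤1+n v

cyclicᵇ-punchInℕ : ∀ s a b c → cyclicᵇ (punchInℕ s a) (punchInℕ s b) (punchInℕ s c) ≡ cyclicᵇ a b c
cyclicᵇ-punchInℕ s a b c =
  T-injective (fromCyclic ∘ Cyclic-map (punchInℕ-cancel-< s) (punchInℕ-cancel-< s) (punchInℕ-cancel-< s) ∘ toCyclic)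
              (fromCyclic ∘ Cyclic-map (punchInℕ-mono-< s) (punchInℕ-mono-< s) (punchInℕ-mono-< s) ∘ toCyclic)

insertAt : ∀ {M} → (Fin M → ℕ) → ℕ → Fin (suc M) → ℕ
insertAt {zero}  p s zero    = s
insertAt {suc M} p s zero    = punchInℕ s (p zero)
insertAt {suc M} p s (suc x) = insertAt (p ∘ suc) s x

insertAt-inject₁ : ∀ {M} (p : Fin M → ℕ) s x → insertAt p s (inject₁ x) ≡ punchInℕ s (p x)
insertAt-inject₁ {suc M} p s zero    = refl
insertAt-inject₁ {suc M} p s (suc x) = insertAt-inject₁ (p ∘ suc) s x

insertAt-fromℕ : ∀ {M} (p : Fin M → ℕ) s → insertAt p s (fromℕ M) ≡ s
insertAt-fromℕ {zero}  p s = refl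
insertAt-fromℕ {suc M} p s = insertAt-fromℕ (p ∘ suc) s

insertAt-cong : ∀ {M} {p p′ : Fin M → ℕ} {s s′} → (∀ x → p x ≡ p′ x) → s ≡ s′ →
  ∀ x → insertAt p s x ≡ insertAt p′ s′ x
insertAt-cong {p = p} {p′} {s} e refl x with view x
... | ‵inject₁ a = trans (insertAt-inject₁ p s a) (trans (cong (punchInℕ s) (e a)) (sym (insertAt-inject₁ p′ s a)))
... | ‵fromℕ     = trans (insertAt-fromℕ p s) (sym (insertAt-fromℕ p′ s))

insertAt-isPermutation : ∀ {M} (p : Fin M → ℕ) s → IsPermutation p → s ≤ M → IsPermutation (insertAt p s)
insertAt-isPermutation {M} p s (inj , bound) s≤M = inj′ , bound′
  where
  inj′ : Injective _≡_ _≡_ (insertAt p s)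
  inj′ {x} {y} e with view x | view y
  ... | ‵inject₁ a | ‵inject₁ b =
    cong inject₁ (inj (punchInℕ-injective s (trans (sym (insertAt-inject₁ p s a)) (trans e (insertAt-inject₁ p s b)))))
  ... | ‵inject₁ a | ‵fromℕ =
    ⊥-elim (punchInℕ-≢ s (p a) (trans (sym (insertAt-inject₁ p s a)) (trans e (insertAt-fromℕ p s))))
  ... | ‵fromℕ | ‵inject₁ b =
    ⊥-elim (punchInℕ-≢ s (p b) (trans (sym (insertAt-inject₁ p s b)) (trans (sym e) (insertAt-fromℕ p s))))
  ... | ‵fromℕ | ‵fromℕ = refl
  bound′ : ∀ x → insertAt p s x < suc M
  bound′ x with view x
  ... | ‵fromℕ rewrite insertAt-fromℕ p s = s≤s s≤M
  ... | ‵inject₁ a rewrite insertAt-inject₁ p s a with p a <? s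
  ... | yes q rewrite punchInℕ-< q = m<n⇒m<1+n (bound a)
  ... | no q rewrite punchInℕ-≥ (≮⇒≥ q) = s≤s (bound a)

restrict : ∀ {M} → Rel3 (suc M) → Rel3 M
restrict Z x y z = Z (inject₁ x) (inject₁ y) (inject₁ z)

restrict-orderBy-insertAt : ∀ {M} (p : Fin M → ℕ) s x y z → restrict (orderBy (insertAt p s)) x y z ≡ orderBy p x y z
restrict-orderBy-insertAt p s x y z
  rewrite insertAt-inject₁ p s x | insertAt-inject₁ p s y | insertAt-inject₁ p s z = cyclicᵇ-punchInℕ s (p x) (p y) (p z)

-- Every permutation of {0, …, M} arises by inserting its last element into a permutation of {0, …, M-1}.
module Deletion {M} (q : Fin (suc M) → ℕ) (perm : IsPermutation q) where

  s : ℕ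
  s = q (fromℕ M)

  p : Fin M → ℕ
  p x = punchOutℕ s (q (inject₁ x))

  private
    q-inject₁-≢ : ∀ x → q (inject₁ x) ≢ s
    q-inject₁-≢ x e = fromℕ≢inject₁ (sym (proj₁ perm e))

  insertAt-deleted : ∀ x → insertAt p s x ≡ q x
  insertAt-deleted x with view x
  ... | ‵inject₁ a = trans (insertAt-inject₁ p s a) (punchInℕ-punchOutℕ s _ (q-inject₁-≢ a))
  ... | ‵fromℕ     = insertAt-fromℕ p s

  s≤M : s ≤ M
  s≤M = ≤-pred (proj₂ perm (fromℕ M))

  p-isPermutation : IsPermutation p
  p-isPermutation = inj , bound
    where
    inj : Injective _≡_ _≡_ p
    inj {x} {y} e = inject₁-injective (proj₁ perm
      (trans (sym (punchInℕ-punchOutℕ s _ (q-inject₁-≢ x)))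
             (trans (cong (punchInℕ s) e) (punchInℕ-punchOutℕ s _ (q-inject₁-≢ y)))))
    bound : ∀ x → p x < M
    bound x with q (inject₁ x) <? s
    ... | yes r rewrite punchOutℕ-< r = <-≤-trans r s≤M
    ... | no r rewrite punchOutℕ-≥ (≮⇒≥ r) =
      pred-< (≤∧≢⇒< (≮⇒≥ r) (≢-sym (q-inject₁-≢ x))) (proj₂ perm (inject₁ x))
      where
      pred-< : ∀ {v} → s < v → v < suc M → pred v < M
      pred-< {suc v} _ (s≤s h) = h

Any-filter⁺ : ∀ {A : Set} {P Q : A → Set} (Q? : Decidable Q) {xs} → Any (λ x → P x × Q x) xs → Any P (filter Q? xs)
Any-filter⁺ Q? {x ∷ xs} (here (p , q)) with Q? x
... | yes _ = here p
... | no ¬q = ⊥-elim (¬q q)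
Any-filter⁺ Q? {x ∷ xs} (there a) with Q? x
... | yes _ = there (Any-filter⁺ Q? a)
... | no _  = Any-filter⁺ Q? a

AllPairs-concatMap⁺ : ∀ {X A : Set} {R : A → A → Set} {S : X → X → Set} (F : X → List A) {xs} →
  AllPairs S xs → (∀ x → AllPairs R (F x)) → (∀ {x y} → S x y → All (λ a → All (R a) (F y)) (F x)) →
  AllPairs R (concatMap F xs)
AllPairs-concatMap⁺ F {xs} S-xs R-F cross =
  AllPairs.concat⁺ (All.map⁺ (All.universal R-F xs)) (AllPairs.map⁺ (AllPairs.map cross S-xs))

AllPairs-map⁺-on : ∀ {A B : Set} {R : A → A → Set} {R′ : B → B → Set} {I : A → Set} (f : A → B) →
  (∀ {x y} → I x → I y → R x y → R′ (f x) (f y)) → ∀ {xs} → All I xs → AllPairs R xs → AllPairs R′ (map f xs)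
AllPairs-map⁺-on f h [] [] = []
AllPairs-map⁺-on {R = R} {R′} {I} f h {x ∷ xs} (i ∷ is) (p ∷ ps) = heads is p ∷ AllPairs-map⁺-on f h is ps
  where
  heads : ∀ {ys} → All I ys → All (R x) ys → All (R′ (f x)) (map f ys)
  heads []       []       = []
  heads (j ∷ js) (q ∷ qs) = h i j q ∷ heads js qs

module Enumeration (S : Setoid 0ℓ 0ℓ) where
  open Setoid S using (_≈_) renaming (Carrier to A; sym to ≈-sym; trans to ≈-trans)
  open import Data.List.Membership.Setoid S using (_∈_)
  open import Data.List.Relation.Unary.Unique.Setoid S using (Unique)

  private
    remove : ∀ {a} (xs : List A) → a ∈ xs → List A
    remove (x ∷ xs) (here _)  = xs
    remove (x ∷ xs) (there i) = x ∷ remove xs i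

    length-remove : ∀ {a} (xs : List A) (i : a ∈ xs) → length xs ≡ suc (length (remove xs i))
    length-remove (x ∷ xs) (here _)  = refl
    length-remove (x ∷ xs) (there i) = cong suc (length-remove xs i)

    ∈-remove : ∀ {a b} (xs : List A) (i : a ∈ xs) → b ∈ xs → ¬ a ≈ b → b ∈ remove xs i
    ∈-remove (x ∷ xs) (here p)  (here q)  n = ⊥-elim (n (≈-trans p (≈-sym q)))
    ∈-remove (x ∷ xs) (here p)  (there j) n = j
    ∈-remove (x ∷ xs) (there i) (here q)  n = here q
    ∈-remove (x ∷ xs) (there i) (there j) n = there (∈-remove xs i j n)

  Unique⇒length-≤ : ∀ {us} vs → Unique us → All (_∈ vs) us → length us ≤ length vs
  Unique⇒length-≤ {[]}     vs _           _        = z≤n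
  Unique⇒length-≤ {u ∷ us} vs (u∉ ∷ uus) (i ∷ is) =
    subst (suc (length us) ≤_) (sym (length-remove vs i))
      (s≤s (Unique⇒length-≤ (remove vs i) uus (All.zipWith (λ (n , j) → ∈-remove vs i j n) (u∉ , is))))

  Enumerates : (A → Set) → List A → Set
  Enumerates E xs = All E xs × Unique xs × (∀ a → E a → a ∈ xs)

  enumerations-length : ∀ {E : A → Set} {us vs} → Enumerates E us → Enumerates E vs → length us ≡ length vs
  enumerations-length {us = us} {vs} (E-us , u-us , c-us) (E-vs , u-vs , c-vs) =
    ≤-antisym (Unique⇒length-≤ vs u-us (All.map (c-vs _) E-us)) (Unique⇒length-≤ us u-vs (All.map (c-us _) E-vs))

module AllFunctions {B : Set} (_≈B_ : B → B → Set) (bs : List B)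
  (bs-complete : ∀ b → Any (b ≈B_) bs) (bs-unique : AllPairs (λ a b → ¬ a ≈B b) bs) where

  _≈F_ : ∀ {n} → (Fin n → B) → (Fin n → B) → Set
  f ≈F g = ∀ i → f i ≈B g i

  allFunsOver-complete : ∀ n (f : Fin n → B) → Any (f ≈F_) (allFunsOver bs n)
  allFunsOver-complete zero    f = here (λ ())
  allFunsOver-complete (suc n) f =
    Any.concatMap⁺ (λ b → map (consF b) (allFunsOver bs n))
      (Any.map (λ {b} f0≈b → Any.map⁺ (Any.map (λ {g} f∘suc≈g → λ { zero → f0≈b ; (suc i) → f∘suc≈g i })
                                                (allFunsOver-complete n (f ∘ suc))))
               (bs-complete (f zero)))

  allFunsOver-unique : ∀ n → AllPairs (λ f g → ¬ f ≈F g) (allFunsOver bs n)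
  allFunsOver-unique zero    = [] ∷ []
  allFunsOver-unique (suc n) =
    AllPairs-concatMap⁺ (λ b → map (consF b) (allFunsOver bs n)) bs-unique
      (λ b → AllPairs.map⁺ (AllPairs.map (λ f≉g e → f≉g (e ∘ suc)) (allFunsOver-unique n)))
      (λ {b} {b′} b≉b′ → All.map⁺ (All.universal (λ g → All.map⁺ (All.universal (λ g′ e → b≉b′ (e zero)) _)) _))

_≗₃_ : ∀ {m} → Rel3 m → Rel3 m → Set
Z ≗₃ Z′ = ∀ x y z → Z x y z ≡ Z′ x y z

≗₃-sym : ∀ {m} {Z Z′ : Rel3 m} → Z ≗₃ Z′ → Z′ ≗₃ Z
≗₃-sym e x y z = sym (e x y z)

≗₃-trans : ∀ {m} {Z Z′ Z″ : Rel3 m} → Z ≗₃ Z′ → Z′ ≗₃ Z″ → Z ≗₃ Z″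
≗₃-trans e f x y z = trans (e x y z) (f x y z)

Rel3-setoid : ℕ → Setoid 0ℓ 0ℓ
Rel3-setoid m = record
  { Carrier = Rel3 m ; _≈_ = _≗₃_
  ; isEquivalence = record { refl = λ _ _ _ → refl ; sym = ≗₃-sym ; trans = ≗₃-trans } }

private
  bools-complete : ∀ b → Any (b ≡_) (true ∷ false ∷ [])
  bools-complete true  = here refl
  bools-complete false = there (here refl)

  bools-unique : AllPairs (λ a b → ¬ a ≡ b) (true ∷ false ∷ [])
  bools-unique = ((λ ()) ∷ []) ∷ [] ∷ []

  module BoolFunctions (m : ℕ) = AllFunctions _≡_ (true ∷ false ∷ []) bools-complete bools-unique
  module BinaryRelations (m : ℕ) =
    AllFunctions (BoolFunctions._≈F_ m {m}) (allFunsOver (true ∷ false ∷ []) m)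
                 (BoolFunctions.allFunsOver-complete m m) (BoolFunctions.allFunsOver-unique m m)
  module TernaryRelations (m : ℕ) =
    AllFunctions (BinaryRelations._≈F_ m {m}) (allFunsOver (allFunsOver (true ∷ false ∷ []) m) m)
                 (BinaryRelations.allFunsOver-complete m m) (BinaryRelations.allFunsOver-unique m m)

allRel3-complete : ∀ m (Z : Rel3 m) → Any (Z ≗₃_) (allRel3 m)
allRel3-complete m = TernaryRelations.allFunsOver-complete m m

allRel3-unique : ∀ m → AllPairs (λ Z Z′ → ¬ Z ≗₃ Z′) (allRel3 m)
allRel3-unique m = TernaryRelations.allFunsOver-unique m m

-- Coefficients of polynomials as lengths of lists

coeff-∷ : ∀ t P i j k → coeff (t ∷ P) i j k ≡ coeff (t ∷ []) i j k +ℤ coeff P i j k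
coeff-∷ (c , e) P i j k with ⌊ e x₁ ≟ i ⌋ | ⌊ e x₂ ≟ j ⌋ | ⌊ e x₃ ≟ k ⌋
... | true  | true  | true  = cong (_+ℤ coeff P i j k) (sym (ℤₚ.+-identityʳ c))
... | true  | true  | false = refl
... | true  | false | _     = refl
... | false | _     | _     = refl

coeff-++ : ∀ P Q i j k → coeff (P ++ Q) i j k ≡ coeff P i j k +ℤ coeff Q i j k
coeff-++ []      Q i j k = sym (ℤₚ.+-identityˡ _)
coeff-++ (t ∷ P) Q i j k = begin
  coeff (t ∷ P ++ Q) i j k                                 ≡⟨ coeff-∷ t (P ++ Q) i j k ⟩
  coeff (t ∷ []) i j k +ℤ coeff (P ++ Q) i j k               ≡⟨ cong (coeff (t ∷ []) i j k +ℤ_) (coeff-++ P Q i j k) ⟩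
  coeff (t ∷ []) i j k +ℤ (coeff P i j k +ℤ coeff Q i j k)   ≡⟨ sym (ℤₚ.+-assoc (coeff (t ∷ []) i j k) _ _) ⟩
  coeff (t ∷ []) i j k +ℤ coeff P i j k +ℤ coeff Q i j k     ≡⟨ cong (_+ℤ coeff Q i j k) (sym (coeff-∷ t P i j k)) ⟩
  coeff (t ∷ P) i j k +ℤ coeff Q i j k                       ∎
  where open ≡-Reasoning

Φ-++ : ∀ a b c (b≢c : b ≢ c) P Q → Φ a b c b≢c (P ++ Q) ≡ Φ a b c b≢c P ++ Φ a b c b≢c Q
Φ-++ a b c b≢c []            Q = refl
Φ-++ a b c b≢c ((n , e) ∷ P) Q =
  trans (cong (terms ++_) (Φ-++ a b c b≢c P Q)) (sym (List.++-assoc terms (Φ a b c b≢c P) (Φ a b c b≢c Q)))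
  where terms = map (λ k′ → n , Φmono a b c e k′) (upTo (suc (e c)))

module CoefficientAt (i j k : ℕ) where

  select : ∀ {Y : Set} → Mono → List Y → List Y
  select e ys = if ⌊ e x₁ ≟ i ⌋ then (if ⌊ e x₂ ≟ j ⌋ then (if ⌊ e x₃ ≟ k ⌋ then ys else []) else []) else []

  select-All : ∀ {Y : Set} {P : Y → Set} (e : Mono) (ys : List Y) →
    (e x₁ ≡ i → e x₂ ≡ j → e x₃ ≡ k → All P ys) → All P (select e ys)
  select-All e ys f with e x₁ ≟ i | e x₂ ≟ j | e x₃ ≟ k
  ... | yes p | yes q | yes r = f p q r
  ... | yes _ | yes _ | no _  = []
  ... | yes _ | no _  | _     = []
  ... | no _  | _     | _     = []

  select-AllPairs : ∀ {Y : Set} {R : Y → Y → Set} (e : Mono) (ys : List Y) → AllPairs R ys → AllPairs R (select e ys)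
  select-AllPairs e ys u with e x₁ ≟ i | e x₂ ≟ j | e x₃ ≟ k
  ... | yes _ | yes _ | yes _ = u
  ... | yes _ | yes _ | no _  = []
  ... | yes _ | no _  | _     = []
  ... | no _  | _     | _     = []

  select-Any : ∀ {Y : Set} {P : Y → Set} (e : Mono) (ys : List Y) →
    e x₁ ≡ i → e x₂ ≡ j → e x₃ ≡ k → Any P ys → Any P (select e ys)
  select-Any e ys p q r a with e x₁ ≟ i | e x₂ ≟ j | e x₃ ≟ k
  ... | yes _ | yes _ | yes _ = a
  ... | yes _ | yes _ | no ¬r = ⊥-elim (¬r r)
  ... | yes _ | no ¬q | _     = ⊥-elim (¬q q)
  ... | no ¬p | _     | _     = ⊥-elim (¬p p)

  CountedBy : ∀ {Y : Set} → Poly → List Y → Set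
  CountedBy P ys = coeff P i j k ≡ ℤ.+ length ys

  CountedBy-++ : ∀ {Y : Set} P Q (ys zs : List Y) → CountedBy P ys → CountedBy Q zs → CountedBy (P ++ Q) (ys ++ zs)
  CountedBy-++ P Q ys zs P-ys Q-zs =
    trans (coeff-++ P Q i j k) (trans (cong₂ _+ℤ_ P-ys Q-zs) (cong ℤ.+_ (sym (List.length-++ ys))))

  CountedBy-term : ∀ {Y : Set} (n : ℕ) (e : Mono) (ys : List Y) → length ys ≡ n → CountedBy ((ℤ.+ n , e) ∷ []) (select e ys)
  CountedBy-term n e ys eq with ⌊ e x₁ ≟ i ⌋ | ⌊ e x₂ ≟ j ⌋ | ⌊ e x₃ ≟ k ⌋
  ... | true  | true  | true  = trans (ℤₚ.+-identityʳ _) (cong ℤ.+_ (sym eq))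
  ... | true  | true  | false = refl
  ... | true  | false | _     = refl
  ... | false | _     | _     = refl

  CountedBy-concatMap : ∀ {X Y : Set} (F : X → Poly) (G : X → List Y) → (∀ x → CountedBy (F x) (G x)) →
    ∀ xs → CountedBy (concatMap F xs) (concatMap G xs)
  CountedBy-concatMap F G r []       = refl
  CountedBy-concatMap F G r (x ∷ xs) = CountedBy-++ (F x) _ (G x) _ (r x) (CountedBy-concatMap F G r xs)

  CountedBy-map : ∀ {X Y : Set} (F : X → ℤ × Mono) (G : X → List Y) → (∀ x → CountedBy (F x ∷ []) (G x)) →
    ∀ xs → CountedBy (map F xs) (concatMap G xs)
  CountedBy-map F G r []       = refl
  CountedBy-map F G r (x ∷ xs) =
    trans (coeff-∷ (F x) (map F xs) i j k)
          (trans (cong₂ _+ℤ_ (r x) (CountedBy-map F G r xs)) (cong ℤ.+_ (sym (List.length-++ (G x)))))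

  module _ (a b c : Fin 3) (b≢c : b ≢ c) where

    CountedBy-Φ-concatMap : ∀ {X Y : Set} (F : X → Poly) (G : X → List Y) → (∀ x → CountedBy (Φ a b c b≢c (F x)) (G x)) →
      ∀ xs → CountedBy (Φ a b c b≢c (concatMap F xs)) (concatMap G xs)
    CountedBy-Φ-concatMap F G r []       = refl
    CountedBy-Φ-concatMap F G r (x ∷ xs) =
      trans (cong (λ P → coeff P i j k) (Φ-++ a b c b≢c (F x) (concatMap F xs)))
            (CountedBy-++ (Φ a b c b≢c (F x)) _ (G x) _ (r x) (CountedBy-Φ-concatMap F G r xs))

    CountedBy-Φ-map : ∀ {X Y : Set} (F : X → ℤ × Mono) (G : X → List Y) →
      (∀ x → CountedBy (Φ a b c b≢c (F x ∷ [])) (G x)) →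
      ∀ xs → CountedBy (Φ a b c b≢c (map F xs)) (concatMap G xs)
    CountedBy-Φ-map F G r []       = refl
    CountedBy-Φ-map F G r (x ∷ xs) =
      trans (cong (λ P → coeff P i j k) (Φ-++ a b c b≢c (F x ∷ []) (map F xs)))
            (CountedBy-++ (Φ a b c b≢c (F x ∷ [])) _ (G x) _ (r x) (CountedBy-Φ-map F G r xs))

    -- Φ sends n X^e to the sum over k' ≤ e_c of n X^(Φmono e k'), so its coefficient counts the pairs (y, k').
    CountedBy-Φ-term : ∀ {W : Set} (n : ℕ) (e : Mono) (L : List W) → length L ≡ n →
      CountedBy (Φ a b c b≢c ((ℤ.+ n , e) ∷ []))
                (concatMap (λ k′ → select (Φmono a b c e k′) (map (_, k′) L)) (upTo (suc (e c))))
    CountedBy-Φ-term n e L eq =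
      trans (cong (λ P → coeff P i j k) (List.++-identityʳ (map (λ k′ → (ℤ.+ n , Φmono a b c e k′)) (upTo (suc (e c))))))
        (CountedBy-map (λ k′ → (ℤ.+ n , Φmono a b c e k′)) (λ k′ → select (Φmono a b c e k′) (map (_, k′) L))
          (λ k′ → CountedBy-term n (Φmono a b c e k′) (map (_, k′) L) (trans (List.length-map _ L) eq)) (upTo (suc (e c))))

AllPairs-concatMap-keyed : ∀ {A : Set} (_≈_ : A → A → Set) (key : A → ℕ) → (∀ {x y} → x ≈ y → key x ≡ key y) →
  (B : ℕ → List A) → (∀ t → All (λ x → key x ≡ t) (B t)) → (∀ t → AllPairs (λ a b → ¬ a ≈ b) (B t)) →
  ∀ N → AllPairs (λ a b → ¬ a ≈ b) (concatMap B (upTo N))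
AllPairs-concatMap-keyed _≈_ key key-cong B keyed unique N =
  AllPairs-concatMap⁺ B (upTo⁺ N) unique
    (λ {t} {t′} t≢t′ → All.map (λ {x} kx → All.map (λ {y} ky x≈y → t≢t′ (trans (sym kx) (trans (key-cong x≈y) ky)))
                                                  (keyed t′))
                               (keyed t))

lookup-∷ʳ-inject₁ : ∀ {n} (w : Vec Sign n) ε (p : Fin n) → lookup (w ∷ʳ ε) (inject₁ p) ≡ lookup w p
lookup-∷ʳ-inject₁ (x ∷ w) ε zero    = refl
lookup-∷ʳ-inject₁ (x ∷ w) ε (suc p) = lookup-∷ʳ-inject₁ w ε p

lookup-∷ʳ-fromℕ : ∀ {n} (w : Vec Sign n) ε → lookup (w ∷ʳ ε) (fromℕ n) ≡ ε
lookup-∷ʳ-fromℕ []      ε = refl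
lookup-∷ʳ-fromℕ (x ∷ w) ε = lookup-∷ʳ-fromℕ w ε

Has-resp : ∀ {m} {Z Z′ : Rel3 m} → Z ≗₃ Z′ → ∀ {x y z} → Has Z x y z → Has Z′ x y z
Has-resp e {x} {y} {z} = subst T (e x y z)

SignCond-resp : ∀ {m} {Z Z′ : Rel3 m} → Z ≗₃ Z′ → ∀ s {x y z} → SignCond s Z x y z → SignCond s Z′ x y z
SignCond-resp e ⊕ = Has-resp e
SignCond-resp e ⊖ = Has-resp e

InP-resp : ∀ {n} (w : Vec Sign n) {Z Z′} → Z ≗₃ Z′ → InP w Z → InP w Z′
InP-resp w e h p = SignCond-resp e (lookup w p) (h p)

IsTotalCyclicOrder-resp : ∀ {m} {Z Z′ : Rel3 m} → Z ≗₃ Z′ → IsTotalCyclicOrder Z → IsTotalCyclicOrder Z′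
IsTotalCyclicOrder-resp {Z = Z} {Z′} e (d , c , a , t , to) =
    (λ x y z h → d x y z (⇐ h))
  , (λ x y z h → ⇒ (c x y z (⇐ h)))
  , (λ x y z h h′ → a x y z (⇐ h) (⇐ h′))
  , (λ x y z u h h′ → ⇒ (t x y z u (⇐ h) (⇐ h′)))
  , (λ x y z ds → Data.Sum.map ⇒ ⇒ (to x y z ds))
  where
  import Data.Sum
  ⇒ : ∀ {x y z} → Has Z x y z → Has Z′ x y z
  ⇒ = Has-resp e
  ⇐ : ∀ {x y z} → Has Z′ x y z → Has Z x y z
  ⇐ = Has-resp (≗₃-sym e)

cZ≡count : ∀ {m} (Z : Rel3 m) a b → cZ Z a b ≡ count m (λ x → Z a x b)
cZ≡count {m} Z a b = length-filter-tabulate m (λ x → Z a x b) (λ x → x)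

cZ-resp : ∀ {m} {Z Z′ : Rel3 m} → Z ≗₃ Z′ → ∀ a b → cZ Z a b ≡ cZ Z′ a b
cZ-resp {m} {Z} {Z′} e a b = trans (cZ≡count Z a b) (trans (count-cong m (λ x → e a x b)) (sym (cZ≡count Z′ a b)))

position-resp : ∀ {M} {Z Z′ : Rel3 (suc M)} → Z ≗₃ Z′ → ∀ x → position Z x ≡ position Z′ x
position-resp e zero    = refl
position-resp {M} e (suc x) = cong suc (count-cong (suc M) (λ y → e zero y (suc x)))

orderBy-resp : ∀ {M} {p q : Fin M → ℕ} → (∀ x → p x ≡ q x) → orderBy p ≗₃ orderBy q
orderBy-resp e x y z rewrite e x | e y | e z = refl

restrict-resp : ∀ {M} {Z Z′ : Rel3 (suc M)} → Z ≗₃ Z′ → restrict Z ≗₃ restrict Z′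
restrict-resp e x y z = e _ _ _

InP-∷ʳ : ∀ {n} (w : Vec Sign n) ε (Z : Rel3 (suc (suc (suc n)))) → InP w (restrict Z) →
  SignCond ε Z (inject₁ (inject₁ (fromℕ n))) (inject₁ (fromℕ (suc n))) (fromℕ (suc (suc n))) → InP (w ∷ʳ ε) Z
InP-∷ʳ {n} w ε Z h h-last p with view p
... | ‵inject₁ p′ rewrite lookup-∷ʳ-inject₁ w ε p′ = restricted (lookup w p′) (h p′)
  where
  restricted : ∀ s {x y z} → SignCond s (restrict Z) x y z → SignCond s Z (inject₁ x) (inject₁ y) (inject₁ z)
  restricted ⊕ h = h
  restricted ⊖ h = h
... | ‵fromℕ rewrite lookup-∷ʳ-fromℕ w ε = h-last

InP-∷ʳ⁻ˡ : ∀ {n} (w : Vec Sign n) ε (Z : Rel3 (suc (suc (suc n)))) → InP (w ∷ʳ ε) Z → InP w (restrict Z)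
InP-∷ʳ⁻ˡ w ε Z h p = restricted (lookup w p) (subst (λ s → SignCond s Z _ _ _) (lookup-∷ʳ-inject₁ w ε p) (h (inject₁ p)))
  where
  restricted : ∀ s {x y z} → SignCond s Z (inject₁ x) (inject₁ y) (inject₁ z) → SignCond s (restrict Z) x y z
  restricted ⊕ h = h
  restricted ⊖ h = h

InP-∷ʳ⁻ʳ : ∀ {n} (w : Vec Sign n) ε (Z : Rel3 (suc (suc (suc n)))) → InP (w ∷ʳ ε) Z →
  SignCond ε Z (inject₁ (inject₁ (fromℕ n))) (inject₁ (fromℕ (suc n))) (fromℕ (suc (suc n)))
InP-∷ʳ⁻ʳ {n} w ε Z h = subst (λ s → SignCond s Z _ _ _) (lookup-∷ʳ-fromℕ w ε) (h (fromℕ n))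

position-isPermutation : ∀ {M} (Z : Rel3 (suc M)) → IsTotalCyclicOrder Z → IsPermutation (position Z)
position-isPermutation Z tco = position-injective , position-<
  where open TotalCyclicOrder Z tco

≗₃orderBy-position : ∀ {M} (Z : Rel3 (suc M)) → IsTotalCyclicOrder Z → Z ≗₃ orderBy (position Z)
≗₃orderBy-position Z tco = TotalCyclicOrder.≡orderBy-position Z tco

-- Gap vectors in terms of positions

-- 0 < a < b < M, with e1, e2, e3 the numbers of positions strictly between a and b, b and M, 0 and a.
Gaps⁺ : ℕ → ℕ → ℕ → ℕ → ℕ → ℕ → Set
Gaps⁺ M a b e1 e2 e3 = a < b × e1 + suc a ≡ b × e2 + suc b ≡ M × e3 + 1 ≡ a

Gaps : Sign → ℕ → ℕ → ℕ → ℕ → ℕ → ℕ → Set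
Gaps ⊕ M a b = Gaps⁺ M a b
Gaps ⊖ M a b = Gaps⁺ M b a

CyclicSign : Sign → ℕ → ℕ → ℕ → Set
CyclicSign ⊕ a b s = Cyclic a b s
CyclicSign ⊖ a b s = Cyclic s b a

-- After inserting m+1 at position s, the last three elements m-1, m, m+1 sit at a, b, s.
record ExtendedGaps (η ε : Sign) (M a b s i j k : ℕ) : Set where
  constructor extended
  field
    gaps : Gaps η M b s i j k
    sign : CyclicSign ε a b s

ExtendedGaps-subst : ∀ {η ε M a b a′ b′ s i j k} → a ≡ a′ → b ≡ b′ →
  ExtendedGaps η ε M a b s i j k → ExtendedGaps η ε M a′ b′ s i j k
ExtendedGaps-subst refl refl g = g

ExtendedGaps-cong : ∀ {η ε M a b s i j k a′ b′ s′ i′ j′ k′} →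
  a ≡ a′ → b ≡ b′ → s ≡ s′ → i ≡ i′ → j ≡ j′ → k ≡ k′ →
  ExtendedGaps η ε M a b s i j k → ExtendedGaps η ε M a′ b′ s′ i′ j′ k′
ExtendedGaps-cong refl refl refl refl refl refl g = g

OrderedGaps : ∀ {M} → Rel3 (suc M) → Fin (suc M) → Fin (suc M) → ℕ → ℕ → ℕ → Set
OrderedGaps Z x y i j k = Has Z x y zero × cZ Z x y ≡ i × cZ Z y zero ≡ j × cZ Z zero x ≡ k

Cyclic[a,b,0]⇒a<b : ∀ {a b} → Cyclic a b 0 → a < b
Cyclic[a,b,0]⇒a<b (inj₁ (_ , ()))
Cyclic[a,b,0]⇒a<b (inj₂ (inj₁ (() , _)))
Cyclic[a,b,0]⇒a<b (inj₂ (inj₂ (_ , a<b))) = a<b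

cancel-+ʳ : ∀ {x y} z → x + z ≡ y + z → x ≡ y
cancel-+ʳ {x} {y} z e = +-cancelʳ-≡ z x y e

OrderedGaps⇒Gaps⁺ : ∀ {M} (Z : Rel3 (suc M)) → IsTotalCyclicOrder Z → ∀ {x y i j k} →
  OrderedGaps Z x y i j k → Gaps⁺ (suc M) (position Z x) (position Z y) i j k
OrderedGaps⇒Gaps⁺ {M} Z tco {x} {y} (h , ci , cj , ck) =
    x<y
  , trans (cong (_+ suc (q x)) (trans (sym ci) (cZ≡gap x y))) (gap-< x y x<y)
  , trans (cong (_+ suc (q y)) (trans (sym cj) (cZ≡gap y zero))) (trans (gap-> y zero 0<y) (+-identityʳ (suc M)))
  , trans (cong (_+ 1) (trans (sym ck) (cZ≡gap zero x))) (gap-< zero x 0<x)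
  where
  q = position Z
  open Permutation q (position-isPermutation Z tco)
  Z≗ : Z ≗₃ orderBy q
  Z≗ = ≗₃orderBy-position Z tco
  cZ≡gap : ∀ a b → cZ Z a b ≡ gap a b
  cZ≡gap a b = trans (cZ≡count Z a b) (count-cong (suc M) (λ v → Z≗ a v b))
  cyc : Cyclic (q x) (q y) 0
  cyc = toCyclic (Has-resp Z≗ h)
  x<y : q x < q y
  x<y = Cyclic[a,b,0]⇒a<b cyc
  0<x : 0 < q x
  0<x = n≢0⇒n>0 (proj₂ (proj₂ (Cyclic-distinct cyc)))
  0<y : 0 < q y
  0<y = <-trans 0<x x<y

orderBy-OrderedGaps : ∀ {M} (q : Fin (suc M) → ℕ) → IsPermutation q → q zero ≡ 0 → ∀ {x y i j k} →
  Gaps⁺ (suc M) (q x) (q y) i j k → OrderedGaps (orderBy q) x y i j k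
orderBy-OrderedGaps {M} q perm q0 {x} {y} {k = k} (x<y , ei , ej , ek) =
    fromCyclic (subst (Cyclic (q x) (q y)) (sym q0) (inj₂ (inj₂ (0<x , x<y))))
  , trans (cZ≡count (orderBy q) x y) (cancel-+ʳ (suc (q x)) (trans (gap-< x y x<y) (sym ei)))
  , trans (cZ≡count (orderBy q) y zero)
      (cancel-+ʳ (suc (q y)) (trans (gap-> y zero (subst (_< q y) (sym q0) (<-trans 0<x x<y)))
                                    (trans (cong (suc M +_) q0) (trans (+-identityʳ (suc M)) (sym ej)))))
  , trans (cZ≡count (orderBy q) zero x)
      (cancel-+ʳ 1 (trans (cong (λ v → gap zero x + suc v) (sym q0))
                          (trans (gap-< zero x (subst (_< q x) (sym q0) 0<x)) (sym ek))))
  where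
  open Permutation q perm
  0<x : 0 < q x
  0<x = subst (0 <_) ek (<-≤-trans z<s (m≤n+m 1 k))

-- The six insertion rules

≤⇒∃ : ∀ {x y} → x ≤ y → ∃ λ d → y ≡ d + x
≤⇒∃ {x} {y} x≤y = y ∸ x , sym (m∸n+n≡m x≤y)

≤-by : ∀ {x z} y → z ≡ y + x → x ≤ z
≤-by {x} y refl = m≤n+m x y

+-suc-injective : ∀ {x y z} → x + suc y ≡ suc z → x + y ≡ z
+-suc-injective {x} {y} e = suc-injective (trans (sym (+-suc x y)) e)

+-∸-cancel-middle : ∀ d k c → d + k + c ∸ k ≡ d + c
+-∸-cancel-middle d k c = trans (cong (_∸ k) (swap d k c)) (m+n∸n≡m (d + c) k)
  where
  swap : ∀ d k c → d + k + c ≡ d + c + k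
  swap = solve-∀

<-+suc : ∀ x y → x < y + suc x
<-+suc x y = m≤n+m (suc x) y

0<+suc : ∀ x y → 0 < y + suc x
0<+suc x y = <-≤-trans z<s (m≤n+m (suc x) y)

insert-Φ221 : ∀ {M a b e1 e2 e3 k} → Gaps ⊖ M a b e1 e2 e3 → k ≤ e1 →
  0 < suc (b + k) × suc (b + k) ≤ M ×
  ExtendedGaps ⊕ ⊕ (suc M) (punchInℕ (suc (b + k)) a) (punchInℕ (suc (b + k)) b) (suc (b + k))
    k (suc e2 + (e1 ∸ k) + 0) (e3 + 0 + 0 + 0)
insert-Φ221 {e2 = e2} {e3} {k} (_ , refl , refl , refl) k≤e1 with ≤⇒∃ k≤e1
... | d , refl rewrite m+n∸n≡m d k =
  z<s , ≤-by (e2 + d + 1) (M≡ e2 d k e3) ,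
  ExtendedGaps-subst (sym (punchInℕ-≥ s≤a)) (sym (punchInℕ-< b<s))
    (extended (b<s , gap-i k e3 , gap-j e2 d k e3 , gap-k e3) (inj₂ (inj₁ (b<s , s≤s s≤a))))
  where
  a≡ : ∀ d k e3 → d + k + suc (e3 + 1) ≡ d + suc (e3 + 1 + k)
  a≡ = solve-∀
  M≡ : ∀ e2 d k e3 → e2 + suc (d + k + suc (e3 + 1)) ≡ e2 + d + 1 + suc (e3 + 1 + k)
  M≡ = solve-∀
  gap-i : ∀ k e3 → k + suc (e3 + 1) ≡ suc (e3 + 1 + k)
  gap-i = solve-∀
  gap-j : ∀ e2 d k e3 → suc e2 + d + 0 + suc (suc (e3 + 1 + k)) ≡ suc (e2 + suc (d + k + suc (e3 + 1)))
  gap-j = solve-∀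
  gap-k : ∀ e3 → e3 + 0 + 0 + 0 + 1 ≡ e3 + 1
  gap-k = solve-∀
  b<s : e3 + 1 < suc (e3 + 1 + k)
  b<s = s≤s (m≤m+n (e3 + 1) k)
  s≤a : suc (e3 + 1 + k) ≤ d + k + suc (e3 + 1)
  s≤a = ≤-by d (a≡ d k e3)

delete-Φ221 : ∀ {M a b e1 e2 e3 s i j k} → Gaps ⊖ M a b e1 e2 e3 →
  ExtendedGaps ⊕ ⊕ (suc M) (punchInℕ s a) (punchInℕ s b) s i j k →
  i ≤ e1 × suc (b + i) ≡ s × i ≡ i × suc e2 + (e1 ∸ i) + 0 ≡ j × e3 + 0 + 0 + 0 ≡ k
delete-Φ221 {M} {a} {b} {e1} {e2} {e3} {s} {i} {j} {k} (b<a , E1 , E2 , E3) (extended (b'<s , Ei , Ej , Ek) cyc) =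
  i≤e1 , trans (suc-+-comm b i) Ei' , refl , j≡ ,
  trans (+-identityʳ _) (trans (+-identityʳ _) (trans (+-identityʳ _) (cancel-+ʳ 1 (trans E3 (sym Ek')))))
  where
  suc-+-comm : ∀ b i → suc (b + i) ≡ i + suc b
  suc-+-comm = solve-∀
  b-stays = punchInℕ-<-inv b'<s
  Ei' : i + suc b ≡ s
  Ei' = subst (λ v → i + suc v ≡ s) (proj₂ b-stays) Ei
  Ek' : k + 1 ≡ b
  Ek' = subst (λ v → k + 1 ≡ v) (proj₂ b-stays) Ek
  cyc' : Cyclic (punchInℕ s a) b s
  cyc' = subst (λ v → Cyclic (punchInℕ s a) v s) (proj₂ b-stays) cyc
  s≤a : s ≤ a
  s≤a with a <? s
  ... | no p = ≮⇒≥ p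
  ... | yes p with subst (λ v → Cyclic v b s) (punchInℕ-< p) cyc'
  ... | inj₁ (x , _) = ⊥-elim (<-asym x b<a)
  ... | inj₂ (inj₁ (_ , x)) = ⊥-elim (<-asym x p)
  ... | inj₂ (inj₂ (x , _)) = ⊥-elim (<-asym x p)
  i≤e1 : i ≤ e1
  i≤e1 = +-cancelʳ-≤ (suc b) i e1 (subst₂ _≤_ (sym Ei') (sym E1) s≤a)
  d = e1 ∸ i
  e1≡ : e1 ≡ d + i
  e1≡ = sym (m∸n+n≡m i≤e1)
  j≡ : suc e2 + (e1 ∸ i) + 0 ≡ j
  j≡ = cancel-+ʳ (suc s) (begin
      suc e2 + d + 0 + suc s
    ≡⟨ cong (λ v → suc e2 + d + 0 + suc v) (sym Ei') ⟩
      suc e2 + d + 0 + suc (i + suc b)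
    ≡⟨ regroup e2 d i b ⟩
      suc (e2 + suc ((d + i) + suc b))
    ≡⟨ cong (λ v → suc (e2 + suc (v + suc b))) (sym e1≡) ⟩
      suc (e2 + suc (e1 + suc b))
    ≡⟨ cong (λ v → suc (e2 + suc v)) E1 ⟩
      suc (e2 + suc a)
    ≡⟨ cong suc E2 ⟩
      suc M
    ≡⟨ sym Ej ⟩
      j + suc s ∎)
    where
    open ≡-Reasoning
    regroup : ∀ e2 d i b → suc e2 + d + 0 + suc (i + suc b) ≡ suc (e2 + suc ((d + i) + suc b))
    regroup = solve-∀

insert-Φ312 : ∀ {M a b e1 e2 e3 k} → Gaps ⊕ M a b e1 e2 e3 → k ≤ e2 →
  0 < M ∸ k × M ∸ k ≤ M ×
  ExtendedGaps ⊕ ⊕ (suc M) (punchInℕ (M ∸ k) a) (punchInℕ (M ∸ k) b) (M ∸ k) (e2 ∸ k + 0) k (e3 + suc e1 + 0 + 0)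
insert-Φ312 {e1 = e1} {e3 = e3} {k} (_ , refl , refl , refl) k≤e2 with ≤⇒∃ k≤e2
... | d , refl rewrite +-∸-cancel-middle d k (suc (e1 + suc (e3 + 1))) | m+n∸n≡m d k =
  0<+suc B d , ≤-by k (M≡ d k B) ,
  ExtendedGaps-subst (sym (punchInℕ-< (<-trans a<b b<s))) (sym (punchInℕ-< b<s))
    (extended (b<s , cong (_+ suc B) (+-identityʳ d) , gap-j d k B , gap-k e1 e3) (inj₁ (a<b , b<s)))
  where
  B = e1 + suc (e3 + 1)
  M≡ : ∀ d k B → d + k + suc B ≡ k + (d + suc B)
  M≡ = solve-∀
  gap-j : ∀ d k B → k + suc (d + suc B) ≡ suc (d + k + suc B)
  gap-j = solve-∀
  gap-k : ∀ e1 e3 → e3 + suc e1 + 0 + 0 + 1 ≡ e1 + suc (e3 + 1)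
  gap-k = solve-∀
  a<b : e3 + 1 < B
  a<b = <-+suc (e3 + 1) e1
  b<s : B < d + suc B
  b<s = <-+suc B d

delete-Φ312 : ∀ {M a b e1 e2 e3 s i j k} → Gaps ⊕ M a b e1 e2 e3 →
  ExtendedGaps ⊕ ⊕ (suc M) (punchInℕ s a) (punchInℕ s b) s i j k →
  j ≤ e2 × M ∸ j ≡ s × e2 ∸ j + 0 ≡ i × j ≡ j × e3 + suc e1 + 0 + 0 ≡ k
delete-Φ312 {M} {a} {b} {e1} {e2} {e3} {s} {i} {j} {k} (a<b , E1 , E2 , E3) (extended (b'<s , Ei , Ej , Ek) cyc) =
  ≤-by i e2≡ , trans (cong (_∸ j) M≡) (m+n∸m≡n j s) , trans (+-identityʳ _) (trans (cong (_∸ j) e2≡') (m+n∸m≡n j i))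
  , refl , cancel-+ʳ 1 (trans (k-gap e1 e3) (trans (cong (λ v → e1 + suc v) E3) (trans E1 (sym Ek'))))
  where
  regroup : ∀ j i b → j + (i + suc b) ≡ j + i + suc b
  regroup = solve-∀
  k-gap : ∀ e1 e3 → e3 + suc e1 + 0 + 0 + 1 ≡ e1 + suc (e3 + 1)
  k-gap = solve-∀
  b-stays = punchInℕ-<-inv b'<s
  Ei' : i + suc b ≡ s
  Ei' = subst (λ v → i + suc v ≡ s) (proj₂ b-stays) Ei
  Ek' : k + 1 ≡ b
  Ek' = subst (λ v → k + 1 ≡ v) (proj₂ b-stays) Ek
  M≡ : M ≡ j + s
  M≡ = sym (+-suc-injective Ej)
  e2≡' : e2 ≡ j + i
  e2≡' = cancel-+ʳ (suc b) (trans E2 (trans M≡ (trans (cong (j +_) (sym Ei')) (regroup j i b))))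
  e2≡ : e2 ≡ i + j
  e2≡ = trans e2≡' (+-comm j i)

insert-Φ113 : ∀ {M a b e1 e2 e3 k} → Gaps ⊕ M a b e1 e2 e3 → k ≤ e3 →
  0 < suc k × suc k ≤ M ×
  ExtendedGaps ⊖ ⊕ (suc M) (punchInℕ (suc k) a) (punchInℕ (suc k) b) (suc k) (suc e1 + (e3 ∸ k) + 0) (e2 + 0 + 0 + 0) k
insert-Φ113 {e1 = e1} {e2} {k = k} (_ , refl , refl , refl) k≤e3 with ≤⇒∃ k≤e3
... | d , refl rewrite m+n∸n≡m d k =
  z<s , ≤-by (e2 + 1 + e1 + 1 + d) (M≡ e2 e1 d k) ,
  ExtendedGaps-subst (sym (punchInℕ-≥ s≤a)) (sym (punchInℕ-≥ s≤b))
    (extended (s≤s s≤b , gap-i e1 d k , gap-j e2 B , +-comm k 1) (inj₂ (inj₂ (s≤s s≤a , s≤s a<b))))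
  where
  A = d + k + 1
  B = e1 + suc A
  M≡ : ∀ e2 e1 d k → e2 + suc (e1 + suc (d + k + 1)) ≡ e2 + 1 + e1 + 1 + d + suc k
  M≡ = solve-∀
  gap-i : ∀ e1 d k → suc e1 + d + 0 + suc (suc k) ≡ suc (e1 + suc (d + k + 1))
  gap-i = solve-∀
  gap-j : ∀ e2 B → e2 + 0 + 0 + 0 + suc (suc B) ≡ suc (e2 + suc B)
  gap-j = solve-∀
  a≡ : ∀ d k → d + k + 1 ≡ d + suc k
  a≡ = solve-∀
  s≤a : suc k ≤ A
  s≤a = ≤-by d (a≡ d k)
  a<b : A < B
  a<b = <-+suc A e1
  s≤b : suc k ≤ B
  s≤b = ≤-trans s≤a (<⇒≤ a<b)

delete-Φ113 : ∀ {M a b e1 e2 e3 s i j k} → Gaps ⊕ M a b e1 e2 e3 →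
  ExtendedGaps ⊖ ⊕ (suc M) (punchInℕ s a) (punchInℕ s b) s i j k →
  k ≤ e3 × suc k ≡ s × suc e1 + (e3 ∸ k) + 0 ≡ i × e2 + 0 + 0 + 0 ≡ j × k ≡ k
delete-Φ113 {M} {a} {b} {e1} {e2} {e3} {s} {i} {j} {k} (a<b , E1 , E2 , E3) (extended (s<b' , Ei , Ej , Ek) cyc) =
  k≤e3 , trans (+-comm 1 k) Ek , i≡
  , cancel-+ʳ (suc (suc b)) (trans (j-gap e2 b) (trans (cong suc E2) (sym Ej')))
  , refl
  where
  j-gap : ∀ e2 b → e2 + 0 + 0 + 0 + suc (suc b) ≡ suc (e2 + suc b)
  j-gap = solve-∀
  b-shifts = punchInℕ->-inv s<b'
  Ei' : i + suc s ≡ suc b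
  Ei' = subst (λ v → i + suc s ≡ v) (proj₂ b-shifts) Ei
  Ej' : j + suc (suc b) ≡ suc M
  Ej' = subst (λ v → j + suc v ≡ suc M) (proj₂ b-shifts) Ej
  cyc' : Cyclic (punchInℕ s a) (suc b) s
  cyc' = subst (λ v → Cyclic (punchInℕ s a) v s) (proj₂ b-shifts) cyc
  s≤a : s ≤ a
  s≤a with a <? s
  ... | no p = ≮⇒≥ p
  ... | yes p with subst (λ v → Cyclic v (suc b) s) (punchInℕ-< p) cyc'
  ... | inj₁ (_ , x) = ⊥-elim (<-irrefl refl (≤-trans x (≤-trans (proj₁ b-shifts) (n≤1+n b))))
  ... | inj₂ (inj₁ (x , _)) = ⊥-elim (<-irrefl refl (≤-trans x (≤-trans (proj₁ b-shifts) (n≤1+n b))))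
  ... | inj₂ (inj₂ (x , _)) = ⊥-elim (<-asym x p)
  k≤e3 : k ≤ e3
  k≤e3 = +-cancelʳ-≤ 1 k e3 (subst₂ _≤_ (sym Ek) (sym E3) s≤a)
  d = e3 ∸ k
  i≡ : suc e1 + (e3 ∸ k) + 0 ≡ i
  i≡ = cancel-+ʳ (suc s) (begin
      suc e1 + d + 0 + suc s
    ≡⟨ cong (λ v → suc e1 + d + 0 + suc v) (sym Ek) ⟩
      suc e1 + d + 0 + suc (k + 1)
    ≡⟨ regroup e1 d k ⟩
      suc (e1 + suc ((d + k) + 1))
    ≡⟨ cong (λ v → suc (e1 + suc (v + 1))) (m∸n+n≡m k≤e3) ⟩
      suc (e1 + suc (e3 + 1))
    ≡⟨ cong (λ v → suc (e1 + suc v)) E3 ⟩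
      suc (e1 + suc a)
    ≡⟨ cong suc E1 ⟩
      suc b
    ≡⟨ sym Ei' ⟩
      i + suc s ∎)
    where
    open ≡-Reasoning
    regroup : ∀ e1 d k → suc e1 + d + 0 + suc (k + 1) ≡ suc (e1 + suc ((d + k) + 1))
    regroup = solve-∀

ExtendedGaps-⊖⊕⇒a<b : ∀ {M a b s i j k} →
  ExtendedGaps ⊖ ⊕ (suc M) (punchInℕ s a) (punchInℕ s b) s i j k → a ≢ b → a < b
ExtendedGaps-⊖⊕⇒a<b {M} {a} {b} {s} (extended (s<b' , _) cyc) a≢b with punchInℕ->-inv s<b'
... | s≤b , eqb with subst (λ v → Cyclic (punchInℕ s a) v s) eqb cyc
... | inj₁ (_ , x) = ⊥-elim (<-irrefl refl (≤-trans x (≤-trans s≤b (n≤1+n b))))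
... | inj₂ (inj₁ (x , _)) = ⊥-elim (<-irrefl refl (≤-trans x (≤-trans s≤b (n≤1+n b))))
... | inj₂ (inj₂ (_ , x)) = ≤∧≢⇒< (≤-trans (≤-punchInℕ s a) (≤-pred x)) a≢b

insert-Φ112 : ∀ {M a b e1 e2 e3 k} → Gaps ⊖ M a b e1 e2 e3 → k ≤ e2 →
  0 < M ∸ k × M ∸ k ≤ M ×
  ExtendedGaps ⊕ ⊖ (suc M) (punchInℕ (M ∸ k) a) (punchInℕ (M ∸ k) b) (M ∸ k) (suc e1 + (e2 ∸ k) + 0) k (e3 + 0 + 0 + 0)
insert-Φ112 {e1 = e1} {e3 = e3} {k} (_ , refl , refl , refl) k≤e2 with ≤⇒∃ k≤e2
... | d , refl rewrite +-∸-cancel-middle d k (suc (e1 + suc (e3 + 1))) | m+n∸n≡m d k =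
  0<+suc A d , ≤-by k (M≡ d k A) ,
  ExtendedGaps-subst (sym (punchInℕ-< a<s)) (sym (punchInℕ-< (<-trans b<a a<s)))
    (extended (<-trans b<a a<s , gap-i d e1 e3 , gap-j d k A , gap-k e3) (inj₂ (inj₁ (b<a , a<s))))
  where
  A = e1 + suc (e3 + 1)
  M≡ : ∀ d k A → d + k + suc A ≡ k + (d + suc A)
  M≡ = solve-∀
  gap-i : ∀ d e1 e3 → suc e1 + d + 0 + suc (e3 + 1) ≡ d + suc (e1 + suc (e3 + 1))
  gap-i = solve-∀
  gap-j : ∀ d k A → k + suc (d + suc A) ≡ suc (d + k + suc A)
  gap-j = solve-∀
  gap-k : ∀ e3 → e3 + 0 + 0 + 0 + 1 ≡ e3 + 1
  gap-k = solve-∀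
  b<a : e3 + 1 < A
  b<a = <-+suc (e3 + 1) e1
  a<s : A < d + suc A
  a<s = <-+suc A d

delete-Φ112 : ∀ {M a b e1 e2 e3 s i j k} → Gaps ⊖ M a b e1 e2 e3 →
  ExtendedGaps ⊕ ⊖ (suc M) (punchInℕ s a) (punchInℕ s b) s i j k →
  j ≤ e2 × M ∸ j ≡ s × suc e1 + (e2 ∸ j) + 0 ≡ i × j ≡ j × e3 + 0 + 0 + 0 ≡ k
delete-Φ112 {M} {a} {b} {e1} {e2} {e3} {s} {i} {j} {k} (b<a , E1 , E2 , E3) (extended (b'<s , Ei , Ej , Ek) cyc) =
  j≤e2 , trans (cong (_∸ j) M≡) (m+n∸m≡n j s) , i≡ , refl
  , trans (+-identityʳ _) (trans (+-identityʳ _) (trans (+-identityʳ _) (cancel-+ʳ 1 (trans E3 (sym Ek')))))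
  where
  b-stays = punchInℕ-<-inv b'<s
  Ei' : i + suc b ≡ s
  Ei' = subst (λ v → i + suc v ≡ s) (proj₂ b-stays) Ei
  Ek' : k + 1 ≡ b
  Ek' = subst (λ v → k + 1 ≡ v) (proj₂ b-stays) Ek
  cyc' : Cyclic s b (punchInℕ s a)
  cyc' = subst (λ v → Cyclic s v (punchInℕ s a)) (proj₂ b-stays) cyc
  a<s : a < s
  a<s with a <? s
  ... | yes p = p
  ... | no p with subst (λ v → Cyclic s b v) (punchInℕ-≥ (≮⇒≥ p)) cyc'
  ... | inj₁ (x , _) = ⊥-elim (<-asym x (proj₁ b-stays))
  ... | inj₂ (inj₁ (_ , x)) = ⊥-elim (<-irrefl refl (≤-trans x (≤-trans (≮⇒≥ p) (n≤1+n a))))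
  ... | inj₂ (inj₂ (_ , x)) = ⊥-elim (<-asym x (proj₁ b-stays))
  M≡ : M ≡ j + s
  M≡ = sym (+-suc-injective Ej)
  e2a : e2 + suc a ≡ j + s
  e2a = trans E2 M≡
  j≤e2 : j ≤ e2
  j≤e2 = +-cancelʳ-≤ (suc a) j e2 (subst (j + suc a ≤_) (sym e2a) (+-monoʳ-≤ j a<s))
  d = e2 ∸ j
  i≡ : suc e1 + (e2 ∸ j) + 0 ≡ i
  i≡ = cancel-+ʳ (suc b) (cancel-+ʳ (suc a) (begin
      suc e1 + d + 0 + suc b + suc a
    ≡⟨ regroup e1 d b a ⟩
      (d + suc a) + suc (e1 + suc b)
    ≡⟨ cong (λ v → (d + suc a) + suc v) E1 ⟩
      (d + suc a) + suc a
    ≡⟨ cong (_+ suc a) (cancel-+ʳ j (trans (swap d a j) (trans (cong (_+ suc a) (m∸n+n≡m j≤e2)) (trans e2a (+-comm j s))))) ⟩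
      s + suc a
    ≡⟨ cong (_+ suc a) (sym Ei') ⟩
      i + suc b + suc a ∎))
    where
    open ≡-Reasoning
    regroup : ∀ e1 d b a → suc e1 + d + 0 + suc b + suc a ≡ (d + suc a) + suc (e1 + suc b)
    regroup = solve-∀
    swap : ∀ d a j → d + suc a + j ≡ d + j + suc a
    swap = solve-∀

ExtendedGaps-⊕⊖⇒b<a : ∀ {M a b s i j k} →
  ExtendedGaps ⊕ ⊖ (suc M) (punchInℕ s a) (punchInℕ s b) s i j k → a ≢ b → b < a
ExtendedGaps-⊕⊖⇒b<a {M} {a} {b} {s} (extended (b'<s , _) cyc) a≢b with punchInℕ-<-inv b'<s
... | b<s , eqb with subst (λ v → Cyclic s v (punchInℕ s a)) eqb cyc
... | inj₁ (x , _) = ⊥-elim (<-asym x b<s)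
... | inj₂ (inj₂ (_ , x)) = ⊥-elim (<-asym x b<s)
... | inj₂ (inj₁ (x , y)) with a <? s
... | yes p = subst (b <_) (punchInℕ-< p) x
... | no p = ⊥-elim (<-irrefl refl (≤-trans (subst (_< s) (punchInℕ-≥ (≮⇒≥ p)) y) (≤-trans (≮⇒≥ p) (n≤1+n a))))

insert-Φ331 : ∀ {M a b e1 e2 e3 k} → Gaps ⊕ M a b e1 e2 e3 → k ≤ e1 →
  0 < b ∸ k × b ∸ k ≤ M ×
  ExtendedGaps ⊖ ⊖ (suc M) (punchInℕ (b ∸ k) a) (punchInℕ (b ∸ k) b) (b ∸ k) k (e2 + 0 + 0 + 0) (suc e3 + (e1 ∸ k) + 0)
insert-Φ331 {e2 = e2} {e3} {k} (_ , refl , refl , refl) k≤e1 with ≤⇒∃ k≤e1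
... | d , refl rewrite +-∸-cancel-middle d k (suc (e3 + 1)) | m+n∸n≡m d k =
  0<+suc A d , ≤-by (e2 + 1 + k) (M≡ e2 d k A) ,
  ExtendedGaps-subst (sym (punchInℕ-< a<s)) (sym (punchInℕ-≥ s≤b))
    (extended (s≤s s≤b , gap-i d k A , gap-j e2 B , gap-k e3 d) (inj₂ (inj₂ (a<s , s≤s s≤b))))
  where
  A = e3 + 1
  B = d + k + suc A
  M≡ : ∀ e2 d k A → e2 + suc (d + k + suc A) ≡ e2 + 1 + k + (d + suc A)
  M≡ = solve-∀
  b≡ : ∀ d k A → d + k + suc A ≡ k + (d + suc A)
  b≡ = solve-∀
  gap-i : ∀ d k A → k + suc (d + suc A) ≡ suc (d + k + suc A)
  gap-i = solve-∀
  gap-j : ∀ e2 B → e2 + 0 + 0 + 0 + suc (suc B) ≡ suc (e2 + suc B)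
  gap-j = solve-∀
  gap-k : ∀ e3 d → suc e3 + d + 0 + 1 ≡ d + suc (e3 + 1)
  gap-k = solve-∀
  a<s : A < d + suc A
  a<s = <-+suc A d
  s≤b : d + suc A ≤ B
  s≤b = ≤-by k (b≡ d k A)

delete-Φ331 : ∀ {M a b e1 e2 e3 s i j k} → Gaps ⊕ M a b e1 e2 e3 →
  ExtendedGaps ⊖ ⊖ (suc M) (punchInℕ s a) (punchInℕ s b) s i j k →
  i ≤ e1 × b ∸ i ≡ s × i ≡ i × e2 + 0 + 0 + 0 ≡ j × suc e3 + (e1 ∸ i) + 0 ≡ k
delete-Φ331 {M} {a} {b} {e1} {e2} {e3} {s} {i} {j} {k} (a<b , E1 , E2 , E3) (extended (s<b' , Ei , Ej , Ek) cyc) =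
  i≤e1 , trans (cong (_∸ i) b≡) (m+n∸m≡n i s) , refl
  , cancel-+ʳ (suc (suc b)) (trans (j-gap e2 b) (trans (cong suc E2) (sym Ej')))
  , k≡
  where
  j-gap : ∀ e2 b → e2 + 0 + 0 + 0 + suc (suc b) ≡ suc (e2 + suc b)
  j-gap = solve-∀
  b-shifts = punchInℕ->-inv s<b'
  Ei' : i + suc s ≡ suc b
  Ei' = subst (λ v → i + suc s ≡ v) (proj₂ b-shifts) Ei
  Ej' : j + suc (suc b) ≡ suc M
  Ej' = subst (λ v → j + suc v ≡ suc M) (proj₂ b-shifts) Ej
  cyc' : Cyclic s (suc b) (punchInℕ s a)
  cyc' = subst (λ v → Cyclic s v (punchInℕ s a)) (proj₂ b-shifts) cyc
  a<s : a < s
  a<s with a <? s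
  ... | yes p = p
  ... | no p with subst (λ v → Cyclic s (suc b) v) (punchInℕ-≥ (≮⇒≥ p)) cyc'
  ... | inj₁ (_ , x) = ⊥-elim (<-asym a<b (≤-pred x))
  ... | inj₂ (inj₁ (x , _)) = ⊥-elim (<-asym a<b (≤-pred x))
  ... | inj₂ (inj₂ (x , _)) = ⊥-elim (<-irrefl refl (≤-trans x (≤-trans (≮⇒≥ p) (n≤1+n a))))
  b≡ : b ≡ i + s
  b≡ = sym (suc-injective (trans (sym (+-suc i s)) Ei'))
  e1a : e1 + suc a ≡ i + s
  e1a = trans E1 b≡
  i≤e1 : i ≤ e1
  i≤e1 = +-cancelʳ-≤ (suc a) i e1 (subst (i + suc a ≤_) (sym e1a) (+-monoʳ-≤ i a<s))
  d = e1 ∸ i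
  k≡ : suc e3 + (e1 ∸ i) + 0 ≡ k
  k≡ = cancel-+ʳ 1 (cancel-+ʳ i (begin
      suc e3 + d + 0 + 1 + i
    ≡⟨ regroup e3 d i ⟩
      (d + i) + suc (e3 + 1)
    ≡⟨ cong₂ (λ u v → u + suc v) (m∸n+n≡m i≤e1) E3 ⟩
      e1 + suc a
    ≡⟨ e1a ⟩
      i + s
    ≡⟨ cong (i +_) (sym Ek) ⟩
      i + (k + 1)
    ≡⟨ +-comm i (k + 1) ⟩
      k + 1 + i ∎))
    where
    open ≡-Reasoning
    regroup : ∀ e3 d i → suc e3 + d + 0 + 1 + i ≡ (d + i) + suc (e3 + 1)
    regroup = solve-∀

insert-Φ213 : ∀ {M a b e1 e2 e3 k} → Gaps ⊖ M a b e1 e2 e3 → k ≤ e3 →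
  0 < suc k × suc k ≤ M ×
  ExtendedGaps ⊖ ⊖ (suc M) (punchInℕ (suc k) a) (punchInℕ (suc k) b) (suc k) (e3 ∸ k + 0) (e2 + suc e1 + 0 + 0) k
insert-Φ213 {e1 = e1} {e2} {k = k} (_ , refl , refl , refl) k≤e3 with ≤⇒∃ k≤e3
... | d , refl rewrite m+n∸n≡m d k =
  z<s , ≤-by (e2 + 1 + e1 + 1 + d) (M≡ e2 e1 d k) ,
  ExtendedGaps-subst (sym (punchInℕ-≥ (≤-trans s≤b (<⇒≤ b<a)))) (sym (punchInℕ-≥ s≤b))
    (extended (s≤s s≤b , gap-i d k , gap-j e2 e1 B , +-comm k 1) (inj₁ (s≤s s≤b , s≤s b<a)))
  where
  B = d + k + 1
  M≡ : ∀ e2 e1 d k → e2 + suc (e1 + suc (d + k + 1)) ≡ e2 + 1 + e1 + 1 + d + suc k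
  M≡ = solve-∀
  gap-i : ∀ d k → d + 0 + suc (suc k) ≡ suc (d + k + 1)
  gap-i = solve-∀
  gap-j : ∀ e2 e1 B → e2 + suc e1 + 0 + 0 + suc (suc B) ≡ suc (e2 + suc (e1 + suc B))
  gap-j = solve-∀
  b≡ : ∀ d k → d + k + 1 ≡ d + suc k
  b≡ = solve-∀
  s≤b : suc k ≤ B
  s≤b = ≤-by d (b≡ d k)
  b<a : B < e1 + suc B
  b<a = <-+suc B e1

delete-Φ213 : ∀ {M a b e1 e2 e3 s i j k} → Gaps ⊖ M a b e1 e2 e3 →
  ExtendedGaps ⊖ ⊖ (suc M) (punchInℕ s a) (punchInℕ s b) s i j k →
  k ≤ e3 × suc k ≡ s × e3 ∸ k + 0 ≡ i × e2 + suc e1 + 0 + 0 ≡ j × k ≡ k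
delete-Φ213 {M} {a} {b} {e1} {e2} {e3} {s} {i} {j} {k} (b<a , E1 , E2 , E3) (extended (s<b' , Ei , Ej , Ek) cyc) =
  k≤e3 , trans (+-comm 1 k) Ek , i≡ , j≡ , refl
  where
  b-shifts = punchInℕ->-inv s<b'
  Ei' : i + suc s ≡ suc b
  Ei' = subst (λ v → i + suc s ≡ v) (proj₂ b-shifts) Ei
  Ej' : j + suc (suc b) ≡ suc M
  Ej' = subst (λ v → j + suc v ≡ suc M) (proj₂ b-shifts) Ej
  k≤e3 : k ≤ e3
  k≤e3 = +-cancelʳ-≤ 1 k e3 (subst₂ _≤_ (sym Ek) (sym E3) (proj₁ b-shifts))
  i≡ : e3 ∸ k + 0 ≡ i
  i≡ = cancel-+ʳ (suc s) (begin
      e3 ∸ k + 0 + suc s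
    ≡⟨ cong (λ v → e3 ∸ k + 0 + suc v) (sym Ek) ⟩
      e3 ∸ k + 0 + suc (k + 1)
    ≡⟨ regroup (e3 ∸ k) k ⟩
      suc (e3 ∸ k + k + 1)
    ≡⟨ cong (λ v → suc (v + 1)) (m∸n+n≡m k≤e3) ⟩
      suc (e3 + 1)
    ≡⟨ cong suc E3 ⟩
      suc b
    ≡⟨ sym Ei' ⟩
      i + suc s ∎)
    where
    open ≡-Reasoning
    regroup : ∀ d k → d + 0 + suc (k + 1) ≡ suc (d + k + 1)
    regroup = solve-∀
  j≡ : e2 + suc e1 + 0 + 0 ≡ j
  j≡ = cancel-+ʳ (suc (suc b)) (begin
      e2 + suc e1 + 0 + 0 + suc (suc b)
    ≡⟨ regroup′ e2 e1 b ⟩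
      suc (e2 + suc (e1 + suc b))
    ≡⟨ cong (λ v → suc (e2 + suc v)) E1 ⟩
      suc (e2 + suc a)
    ≡⟨ cong suc E2 ⟩
      suc M
    ≡⟨ sym Ej' ⟩
      j + suc (suc b) ∎)
    where
    open ≡-Reasoning
    regroup′ : ∀ e2 e1 b → e2 + suc e1 + 0 + 0 + suc (suc b) ≡ suc (e2 + suc (e1 + suc b))
    regroup′ = solve-∀

Cond : ∀ {n} → Sign → Vec Sign n → ℕ → ℕ → ℕ → Rel3 (suc (suc n)) → Set
Cond ⊕ = Cond⁺
Cond ⊖ = Cond⁻

Cond? : ∀ {n} η (w : Vec Sign n) i j k (Z : Rel3 (suc (suc n))) → Dec (Cond η w i j k Z)
Cond? ⊕ = Cond⁺?
Cond? ⊖ = Cond⁻?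

Q : Sign → ∀ {n} → Vec Sign n → Poly
Q ⊕ = Q⁺
Q ⊖ = Q⁻

Q≡QPoly : ∀ η {n} (w : Vec Sign n) → Q η w ≡ QPoly {n} (λ i j k → length (filter (Cond? η w i j k) (allRel3 (suc (suc n)))))
Q≡QPoly ⊕ w = refl
Q≡QPoly ⊖ w = refl

-- c̃ is read along (m-1, m, 1) for η = + and along (m, m-1, 1) for η = −.
first second : ∀ {n} → Sign → Fin (suc (suc n))
first ⊕ = mm1
first ⊖ = mm
second ⊕ = mm
second ⊖ = mm1

Cond-isTotalCyclicOrder : ∀ {n} η {w : Vec Sign n} {i j k Z} → Cond η w i j k Z → IsTotalCyclicOrder Z
Cond-isTotalCyclicOrder ⊕ c = proj₁ c
Cond-isTotalCyclicOrder ⊖ c = proj₁ c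

Cond-InP : ∀ {n} η {w : Vec Sign n} {i j k Z} → Cond η w i j k Z → InP w Z
Cond-InP ⊕ c = proj₁ (proj₂ c)
Cond-InP ⊖ c = proj₁ (proj₂ c)

Cond-OrderedGaps : ∀ {n} η {w : Vec Sign n} {i j k Z} → Cond η w i j k Z → OrderedGaps Z (first η) (second η) i j k
Cond-OrderedGaps ⊕ (_ , _ , og) = og
Cond-OrderedGaps ⊖ {Z = Z} (tco , _ , h , gaps) = TotalCyclicOrder.rotate Z tco _ _ _ h , gaps

OrderedGaps⇒Cond : ∀ {n} η {w : Vec Sign n} {i j k Z} → IsTotalCyclicOrder Z → InP w Z →
  OrderedGaps Z (first η) (second η) i j k → Cond η w i j k Z
OrderedGaps⇒Cond ⊕ tco ip og = tco , ip , og
OrderedGaps⇒Cond ⊖ {Z = Z} tco ip (h , gaps) = tco , ip , TotalCyclicOrder.rotate² Z tco h , gaps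

Cond-resp : ∀ {n} η {w : Vec Sign n} {i j k Z Z′} → Z ≗₃ Z′ → Cond η w i j k Z → Cond η w i j k Z′
Cond-resp η {w} e c with Cond-OrderedGaps η c
... | h , ci , cj , ck =
  OrderedGaps⇒Cond η (IsTotalCyclicOrder-resp e (Cond-isTotalCyclicOrder η c)) (InP-resp w e (Cond-InP η c))
    (Has-resp e h , trans (sym (cZ-resp e _ _)) ci , trans (sym (cZ-resp e _ _)) cj , trans (sym (cZ-resp e _ _)) ck)

Ordered : Sign → ℕ → ℕ → Set
Ordered ⊕ a b = a < b
Ordered ⊖ a b = b < a

class-⊕-⊖-disjoint : ∀ {n} (Z : Rel3 (suc (suc n))) → IsTotalCyclicOrder Z →
  Has Z (first ⊕) (second ⊕) zero → ¬ Has Z (first ⊖) (second ⊖) zero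
class-⊕-⊖-disjoint {n} Z tco h h′ = asym _ _ _ (rotate _ _ _ h) (rotate _ _ _ h′)
  where open TotalCyclicOrder Z tco

Cond-reindex : ∀ {n} η {w : Vec Sign n} {i j k i′ j′ k′ Z} → i′ ≡ i → j′ ≡ j → k′ ≡ k →
  Cond η w i′ j′ k′ Z → Cond η w i j k Z
Cond-reindex η refl refl refl c = c

Cond-class-unique : ∀ {n} η η′ {w : Vec Sign n} {i j k i′ j′ k′ Z Z′} → Z ≗₃ Z′ →
  Cond η w i j k Z → Cond η′ w i′ j′ k′ Z′ → η ≡ η′
Cond-class-unique ⊕ ⊕ e c c′ = refl
Cond-class-unique ⊖ ⊖ e c c′ = refl
Cond-class-unique ⊕ ⊖ {w} {Z′ = Z′} e c c′ =
  ⊥-elim (class-⊕-⊖-disjoint Z′ (Cond-isTotalCyclicOrder ⊖ {w} c′) (Has-resp e (proj₁ (Cond-OrderedGaps ⊕ {w} c)))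
                                                               (proj₁ (Cond-OrderedGaps ⊖ {w} c′)))
Cond-class-unique ⊖ ⊕ {w} {Z′ = Z′} e c c′ =
  ⊥-elim (class-⊕-⊖-disjoint Z′ (Cond-isTotalCyclicOrder ⊕ {w} c′) (proj₁ (Cond-OrderedGaps ⊕ {w} c′))
                                                               (Has-resp e (proj₁ (Cond-OrderedGaps ⊖ {w} c))))

Ordered-either : ∀ η η′ → η ≢ η′ → ∀ {a b} → a ≢ b → Ordered η a b ⊎ Ordered η′ a b
Ordered-either ⊕ ⊕ η≢η′ _ = ⊥-elim (η≢η′ refl)
Ordered-either ⊖ ⊖ η≢η′ _ = ⊥-elim (η≢η′ refl)
Ordered-either ⊕ ⊖ _ {a} {b} a≢b with <-cmp a b
... | tri< a<b _ _ = inj₁ a<b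
... | tri≈ _ a≡b _ = ⊥-elim (a≢b a≡b)
... | tri> _ _ b<a = inj₂ b<a
Ordered-either ⊖ ⊕ _ {a} {b} a≢b with <-cmp a b
... | tri< a<b _ _ = inj₂ a<b
... | tri≈ _ a≡b _ = ⊥-elim (a≢b a≡b)
... | tri> _ _ b<a = inj₁ b<a

≗mono3 : ∀ (e : Mono) {i j k} → e x₁ ≡ i → e x₂ ≡ j → e x₃ ≡ k → ∀ c → e c ≡ mono3 i j k c
≗mono3 e p q r zero             = p
≗mono3 e p q r (suc zero)       = q
≗mono3 e p q r (suc (suc zero)) = r

gap-sum : ∀ {M a b e1 e2 e3} → Gaps⁺ (suc (suc (suc M))) a b e1 e2 e3 → e1 + e2 + e3 ≡ M
gap-sum {M} {e1 = e1} {e2} {e3} (_ , refl , E2 , refl) = cancel-+ʳ 3 (trans (sum e1 e2 e3) (trans E2 (+-comm 3 M)))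
  where
  sum : ∀ e1 e2 e3 → e1 + e2 + e3 + 3 ≡ e2 + suc (e1 + suc (e3 + 1))
  sum = solve-∀

Gaps-sum : ∀ η {M a b e1 e2 e3} → Gaps η (suc (suc (suc M))) a b e1 e2 e3 → e1 + e2 + e3 ≡ M
Gaps-sum ⊕ = gap-sum
Gaps-sum ⊖ = gap-sum

-- the indices under which QPoly lists the monomial X^(a,b,c) of total degree t
QPoly-indices : ∀ {a b c t} → a + b + c ≡ t → a < suc t × b < suc (t ∸ a) × t ∸ a ∸ b ≡ c
QPoly-indices {a} {b} {c} refl =
    s≤s (m≤m+n a (b + c) ⟨≤-trans⟩ ≤-reflexive (sym (+-assoc a b c)))
  , s≤s (subst (b ≤_) (sym (trans (cong (_∸ a) (+-assoc a b c)) (m+n∸m≡n a (b + c)))) (m≤m+n b c))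
  , trans (cong (_∸ b) (trans (cong (_∸ a) (+-assoc a b c)) (m+n∸m≡n a (b + c)))) (m+n∸m≡n b c)
  where _⟨≤-trans⟩_ = ≤-trans

Cond⇒Gaps : ∀ {n} η {w : Vec Sign n} {i j k Z} → Cond η w i j k Z → Gaps η (suc (suc n)) (position Z mm1) (position Z mm) i j k
Cond⇒Gaps ⊕ {w} {Z = Z} c = OrderedGaps⇒Gaps⁺ Z (proj₁ c) (Cond-OrderedGaps ⊕ {w} c)
Cond⇒Gaps ⊖ {w} {Z = Z} c = OrderedGaps⇒Gaps⁺ Z (proj₁ c) (Cond-OrderedGaps ⊖ {w} c)

orderBy-Cond : ∀ {n} η {w : Vec Sign n} {i j k} (q : Fin (suc (suc n)) → ℕ) → IsPermutation q → q zero ≡ 0 →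
  InP w (orderBy q) → Gaps η (suc (suc n)) (q mm1) (q mm) i j k → Cond η w i j k (orderBy q)
orderBy-Cond ⊕ {w} q perm q0 ip g =
  OrderedGaps⇒Cond ⊕ {w} (orderBy-isTotalCyclicOrder q (proj₁ perm)) ip (orderBy-OrderedGaps q perm q0 g)
orderBy-Cond ⊖ {w} q perm q0 ip g =
  OrderedGaps⇒Cond ⊖ {w} (orderBy-isTotalCyclicOrder q (proj₁ perm)) ip (orderBy-OrderedGaps q perm q0 g)

-- Deleting and inserting the last element

-- |w| = n′ + 1 ≥ 1, so that the n ∸ 1 in QPoly is the true total degree n - 1.
module Extension (n′ : ℕ) (w : Vec Sign (suc n′)) where

  n m : ℕ
  n = suc n′
  m = suc (suc n)

  oA oB : Fin m
  oA = mm1 {n}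
  oB = mm {n}

  nA nB nT : Fin (suc m)
  nA = inject₁ oA
  nB = inject₁ oB
  nT = fromℕ m

  Cond-ExtendedGaps : ∀ η ε {i j k Z′} → Cond η (w ∷ʳ ε) i j k Z′ →
    ExtendedGaps η ε (suc m) (position Z′ nA) (position Z′ nB) (position Z′ nT) i j k
  Cond-ExtendedGaps η ε {Z′ = Z′} c = extended (Cond⇒Gaps η c) (sign ε (InP-∷ʳ⁻ʳ w ε Z′ (Cond-InP η c)))
    where
    q = position Z′
    cyclic : ∀ {x y z} → Has Z′ x y z → Cyclic (q x) (q y) (q z)
    cyclic = toCyclic ∘ Has-resp (≗₃orderBy-position Z′ (Cond-isTotalCyclicOrder η c))
    sign : ∀ ε → SignCond ε Z′ nA nB nT → CyclicSign ε (q nA) (q nB) (q nT)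
    sign ⊕ = cyclic
    sign ⊖ = cyclic

  ExtendedGaps⇒Cond : ∀ η ε {i j k} (q : Fin (suc m) → ℕ) → IsPermutation q → q zero ≡ 0 →
    InP w (restrict (orderBy q)) →
    ExtendedGaps η ε (suc m) (q nA) (q nB) (q nT) i j k → Cond η (w ∷ʳ ε) i j k (orderBy q)
  ExtendedGaps⇒Cond η ε q perm q0 ip (extended gaps cyc) =
    orderBy-Cond η q perm q0 (InP-∷ʳ w ε (orderBy q) ip (sign ε cyc)) gaps
    where
    sign : ∀ ε → CyclicSign ε (q nA) (q nB) (q nT) → SignCond ε (orderBy q) nA nB nT
    sign ⊕ = fromCyclic
    sign ⊖ = fromCyclic

  -- Z′ is obtained by inserting m+1 at position newPos into the order orderBy q on [m].
  module Deleted (Z′ : Rel3 (suc m)) (tco′ : IsTotalCyclicOrder Z′) where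

    q′ : Fin (suc m) → ℕ
    q′ = position Z′

    open Deletion q′ (position-isPermutation Z′ tco′) public
      renaming (s to newPos; p to q; p-isPermutation to q-isPermutation)

    q-zero : q zero ≡ 0
    q-zero = punchOutℕ-0 newPos

    deleted : Rel3 m
    deleted = orderBy q

    deleted-isTotalCyclicOrder : IsTotalCyclicOrder deleted
    deleted-isTotalCyclicOrder = orderBy-isTotalCyclicOrder q (proj₁ q-isPermutation)

    position-deleted : ∀ x → position deleted x ≡ q x
    position-deleted = position-orderBy q q-isPermutation q-zero

    Z′≗insertAt : Z′ ≗₃ orderBy (insertAt q newPos)
    Z′≗insertAt = ≗₃-trans (≗₃orderBy-position Z′ tco′) (orderBy-resp (sym ∘ insertAt-deleted))

    restrict-Z′ : restrict Z′ ≗₃ deleted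
    restrict-Z′ = ≗₃-trans (restrict-resp Z′≗insertAt) (restrict-orderBy-insertAt q newPos)

    q′-nA : q′ nA ≡ punchInℕ newPos (q oA)
    q′-nA = trans (sym (insertAt-deleted nA)) (insertAt-inject₁ q newPos oA)

    q′-nB : q′ nB ≡ punchInℕ newPos (q oB)
    q′-nB = trans (sym (insertAt-deleted nB)) (insertAt-inject₁ q newPos oB)

    q-oA≢q-oB : q oA ≢ q oB
    q-oA≢q-oB e = fromℕ≢inject₁ {i = fromℕ n} (sym (proj₁ q-isPermutation e))

    0<q : ∀ x → x ≢ zero → 0 < q x
    0<q x x≢0 = n≢0⇒n>0 (λ e → x≢0 (proj₁ q-isPermutation (trans e (sym q-zero))))

    deleted-Cond : ∀ η → Ordered η (q oA) (q oB) → InP w deleted →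
      ∃ λ e1 → ∃ λ e2 → ∃ λ e3 → Cond η w e1 e2 e3 deleted
    deleted-Cond ⊕ a<b ip = _ , _ , _ , OrderedGaps⇒Cond ⊕ {w} deleted-isTotalCyclicOrder ip
      (fromCyclic (subst (Cyclic (q oA) (q oB)) (sym q-zero) (inj₂ (inj₂ (0<q oA (λ ()) , a<b)))) , refl , refl , refl)
    deleted-Cond ⊖ b<a ip = _ , _ , _ , OrderedGaps⇒Cond ⊖ {w} deleted-isTotalCyclicOrder ip
      (fromCyclic (subst (Cyclic (q oB) (q oA)) (sym q-zero) (inj₂ (inj₂ (0<q oB (λ ()) , b<a)))) , refl , refl , refl)

    ExtendedGaps-deleted : ∀ {η ε i j k} → Cond η (w ∷ʳ ε) i j k Z′ →
      ExtendedGaps η ε (suc m) (punchInℕ newPos (q oA)) (punchInℕ newPos (q oB)) newPos i j k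
    ExtendedGaps-deleted {η} {ε} c = ExtendedGaps-subst q′-nA q′-nB (Cond-ExtendedGaps η ε c)

  record InsertionRule (η ε : Sign) : Set where
    field
      source : Sign
      Φa Φb Φc : Fin 3
      slot : ℕ → ℕ → ℕ
      insert : ∀ {a b e1 e2 e3 k} → Gaps source m a b e1 e2 e3 → k ≤ mono3 e1 e2 e3 Φc →
        0 < slot b k × slot b k ≤ m ×
        ExtendedGaps η ε (suc m) (punchInℕ (slot b k) a) (punchInℕ (slot b k) b) (slot b k)
          (Φmono Φa Φb Φc (mono3 e1 e2 e3) k x₁) (Φmono Φa Φb Φc (mono3 e1 e2 e3) k x₂)
          (Φmono Φa Φb Φc (mono3 e1 e2 e3) k x₃)
      delete : ∀ {a b e1 e2 e3 s i j k} → Gaps source m a b e1 e2 e3 →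
        ExtendedGaps η ε (suc m) (punchInℕ s a) (punchInℕ s b) s i j k →
        mono3 i j k Φc ≤ mono3 e1 e2 e3 Φc × slot b (mono3 i j k Φc) ≡ s ×
        Φmono Φa Φb Φc (mono3 e1 e2 e3) (mono3 i j k Φc) x₁ ≡ i ×
        Φmono Φa Φb Φc (mono3 e1 e2 e3) (mono3 i j k Φc) x₂ ≡ j ×
        Φmono Φa Φb Φc (mono3 e1 e2 e3) (mono3 i j k Φc) x₃ ≡ k
      Φmono-c : ∀ e k → Φmono Φa Φb Φc e k Φc ≡ k

  rule-Φ221 : InsertionRule ⊕ ⊕
  rule-Φ221 = record { source = ⊖ ; Φa = x₂ ; Φb = x₂ ; Φc = x₁ ; slot = λ b k → suc (b + k)
                     ; insert = insert-Φ221 ; delete = delete-Φ221 ; Φmono-c = λ _ _ → refl }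

  rule-Φ312 : InsertionRule ⊕ ⊕
  rule-Φ312 = record { source = ⊕ ; Φa = x₃ ; Φb = x₁ ; Φc = x₂ ; slot = λ _ k → m ∸ k
                     ; insert = insert-Φ312 ; delete = delete-Φ312 ; Φmono-c = λ _ _ → refl }

  rule-Φ113 : InsertionRule ⊖ ⊕
  rule-Φ113 = record { source = ⊕ ; Φa = x₁ ; Φb = x₁ ; Φc = x₃ ; slot = λ _ k → suc k
                     ; insert = insert-Φ113 ; delete = delete-Φ113 ; Φmono-c = λ _ _ → refl }

  rule-Φ112 : InsertionRule ⊕ ⊖
  rule-Φ112 = record { source = ⊖ ; Φa = x₁ ; Φb = x₁ ; Φc = x₂ ; slot = λ _ k → m ∸ k
                     ; insert = insert-Φ112 ; delete = delete-Φ112 ; Φmono-c = λ _ _ → refl }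

  rule-Φ331 : InsertionRule ⊖ ⊖
  rule-Φ331 = record { source = ⊕ ; Φa = x₃ ; Φb = x₃ ; Φc = x₁ ; slot = λ b k → b ∸ k
                     ; insert = insert-Φ331 ; delete = delete-Φ331 ; Φmono-c = λ _ _ → refl }

  rule-Φ213 : InsertionRule ⊖ ⊖
  rule-Φ213 = record { source = ⊖ ; Φa = x₂ ; Φb = x₁ ; Φc = x₃ ; slot = λ _ k → suc k
                     ; insert = insert-Φ213 ; delete = delete-Φ213 ; Φmono-c = λ _ _ → refl }

  insertPair : ∀ {η ε} → InsertionRule η ε → Rel3 m × ℕ → Rel3 (suc m)
  insertPair R (Z , k) = orderBy (insertAt (position Z) (InsertionRule.slot R (position Z oB) k))

  restrict-insertPair : ∀ {η ε} (R : InsertionRule η ε) Z k → IsTotalCyclicOrder Z → restrict (insertPair R (Z , k)) ≗₃ Z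
  restrict-insertPair R Z k tco = ≗₃-trans (restrict-orderBy-insertAt (position Z) _) (≗₃-sym (≗₃orderBy-position Z tco))

  DeletedOrdered : Sign → (Z′ : Rel3 (suc m)) → IsTotalCyclicOrder Z′ → Set
  DeletedOrdered η Z′ tco′ = Ordered η (q oA) (q oB)
    where open Deleted Z′ tco′

  _≈pair_ : Rel3 m × ℕ → Rel3 m × ℕ → Set
  (Z , a) ≈pair (Z′ , b) = Z ≗₃ Z′ × a ≡ b

  All-concatMap-upTo : ∀ {A : Set} {P : A → Set} (F : ℕ → List A) n →
    (∀ {t} → t < n → All P (F t)) → All P (concatMap F (upTo n))
  All-concatMap-upTo F n h = All.concat⁺ (All.map⁺ (All.applyUpTo⁺₁ (λ t → t) n h))

  Any-concatMap-upTo : ∀ {A : Set} {P : A → Set} (F : ℕ → List A) {t n} → t < n → Any P (F t) → Any P (concatMap F (upTo n))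
  Any-concatMap-upTo F t<n a = Any.concatMap⁺ F (Any.applyUpTo⁺ (λ t → t) a t<n)

  N : ℕ
  N = n ∸ 1

  third : ℕ → ℕ → ℕ
  third i j = N ∸ i ∸ j

  module Term {η ε} (R : InsertionRule η ε) (i j k : ℕ) where
    open InsertionRule R
    open CoefficientAt i j k

    exponents : ℕ → ℕ → Mono
    exponents i′ j′ = mono3 i′ j′ (third i′ j′)

    sources : ℕ → ℕ → List (Rel3 m)
    sources i′ j′ = filter (Cond? source w i′ j′ (third i′ j′)) (allRel3 m)

    block : ℕ → ℕ → ℕ → List (Rel3 m × ℕ)
    block i′ j′ k′ = select (Φmono Φa Φb Φc (exponents i′ j′) k′) (map (_, k′) (sources i′ j′))

    blocks : ℕ → ℕ → List (Rel3 m × ℕ)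
    blocks i′ j′ = concatMap (block i′ j′) (upTo (suc (exponents i′ j′ Φc)))

    pairs : List (Rel3 m × ℕ)
    pairs = concatMap (λ i′ → concatMap (blocks i′) (upTo (suc (N ∸ i′)))) (upTo (suc N))

    inserted : List (Rel3 (suc m))
    inserted = map (insertPair R) pairs

    pairs-counted : ∀ b≢c → CountedBy (Φ Φa Φb Φc b≢c (Q source w)) pairs
    pairs-counted b≢c = subst (λ P → CountedBy (Φ Φa Φb Φc b≢c P) pairs) (sym (Q≡QPoly source w))
      (CountedBy-Φ-concatMap Φa Φb Φc b≢c (λ i′ → map (term i′) (upTo (suc (N ∸ i′))))
        (λ i′ → concatMap (blocks i′) (upTo (suc (N ∸ i′))))
        (λ i′ → CountedBy-Φ-map Φa Φb Φc b≢c (term i′) (blocks i′)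
          (λ j′ → CountedBy-Φ-term Φa Φb Φc b≢c (length (sources i′ j′)) (exponents i′ j′) (sources i′ j′) refl)
          (upTo (suc (N ∸ i′))))
        (upTo (suc N)))
      where
      term : ℕ → ℕ → ℤ × Mono
      term i′ j′ = ℤ.+ length (sources i′ j′) , exponents i′ j′

    All-blocks : ∀ {P : ℕ → ℕ → Rel3 m × ℕ → Set} →
      (∀ {i′ j′ k′ Z} → k′ ≤ exponents i′ j′ Φc → Φmono Φa Φb Φc (exponents i′ j′) k′ x₁ ≡ i →
         Φmono Φa Φb Φc (exponents i′ j′) k′ x₂ ≡ j → Φmono Φa Φb Φc (exponents i′ j′) k′ x₃ ≡ k →
         Cond source w i′ j′ (third i′ j′) Z → P i′ j′ (Z , k′)) →
      ∀ i′ j′ → All (P i′ j′) (blocks i′ j′)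
    All-blocks f i′ j′ = All-concatMap-upTo (block i′ j′) (suc (exponents i′ j′ Φc)) (λ {k′} k′< →
      select-All (Φmono Φa Φb Φc (exponents i′ j′) k′) (map (_, k′) (sources i′ j′)) (λ p q r →
      All.map⁺ (All.map (f (≤-pred k′<) p q r) (All.all-filter (Cond? source w i′ j′ (third i′ j′)) (allRel3 m)))))

    Admissible : Rel3 m × ℕ → Set
    Admissible (Z , k′) = ∃ λ e1 → ∃ λ e2 → ∃ λ e3 → Cond source w e1 e2 e3 Z × k′ ≤ mono3 e1 e2 e3 Φc ×
      Φmono Φa Φb Φc (mono3 e1 e2 e3) k′ x₁ ≡ i × Φmono Φa Φb Φc (mono3 e1 e2 e3) k′ x₂ ≡ j ×
      Φmono Φa Φb Φc (mono3 e1 e2 e3) k′ x₃ ≡ k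

    pairs-admissible : All Admissible pairs
    pairs-admissible = All-concatMap-upTo (λ i′ → concatMap (blocks i′) (upTo (suc (N ∸ i′)))) (suc N) (λ {i′} _ →
      All-concatMap-upTo (blocks i′) (suc (N ∸ i′)) (λ {j′} _ →
      All-blocks {P = λ _ _ → Admissible} (λ {i′} {j′} k′≤ p q r c → i′ , j′ , third i′ j′ , c , k′≤ , p , q , r) i′ j′))

    insert-Cond : ∀ p → Admissible p → Cond η (w ∷ʳ ε) i j k (insertPair R p)
    insert-Cond (Z , k′) (e1 , e2 , e3 , c , k′≤ , p , q , r) with insert (Cond⇒Gaps source {w} c) k′≤
    ... | 0<s , s≤m , gaps =
      ExtendedGaps⇒Cond η ε (insertAt qZ s) (insertAt-isPermutation qZ s (position-isPermutation Z tco) s≤m) (punchInℕ-< 0<s)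
        (InP-resp w (≗₃-trans (≗₃orderBy-position Z tco) (≗₃-sym (restrict-orderBy-insertAt qZ s))) (Cond-InP source c))
        (ExtendedGaps-cong (sym (insertAt-inject₁ qZ s oA)) (sym (insertAt-inject₁ qZ s oB)) (sym (insertAt-fromℕ qZ s)) p q r gaps)
      where
      tco = Cond-isTotalCyclicOrder source c
      qZ = position Z
      s = slot (qZ oB) k′

    inserted-Cond : All (Cond η (w ∷ʳ ε) i j k) inserted
    inserted-Cond = All.map⁺ (All.map (insert-Cond _) pairs-admissible)

    pairs-unique : AllPairs (λ p p′ → ¬ p ≈pair p′) pairs
    pairs-unique = AllPairs-concatMap-keyed _≈pair_ key₁ (λ e → cZ-resp (proj₁ e) _ _)
      (λ i′ → concatMap (blocks i′) (upTo (suc (N ∸ i′))))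
      (λ i′ → All-concatMap-upTo (blocks i′) (suc (N ∸ i′)) (λ {j′} _ →
        All-blocks {P = λ i′ _ p → key₁ p ≡ i′} (λ _ _ _ _ c → proj₁ (proj₂ (Cond-OrderedGaps source {w} c))) i′ j′))
      (λ i′ → AllPairs-concatMap-keyed _≈pair_ key₂ (λ e → cZ-resp (proj₁ e) _ _) (blocks i′)
        (All-blocks {P = λ _ j′ p → key₂ p ≡ j′}
                    (λ _ _ _ _ c → proj₁ (proj₂ (proj₂ (Cond-OrderedGaps source {w} c)))) i′)
        (λ j′ → AllPairs-concatMap-keyed _≈pair_ proj₂ proj₂ (block i′ j′)
          (λ k′ → select-All (Φmono Φa Φb Φc (exponents i′ j′) k′) (map (_, k′) (sources i′ j′))
                    (λ _ _ _ → All.map⁺ (All.universal (λ _ → refl) (sources i′ j′))))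
          (λ k′ → select-AllPairs (Φmono Φa Φb Φc (exponents i′ j′) k′) (map (_, k′) (sources i′ j′))
                    (AllPairs.map⁺ (AllPairs.map (λ Z≉Z′ e → Z≉Z′ (proj₁ e))
                    (AllPairs.filter⁺ (Cond? source w i′ j′ (third i′ j′)) (allRel3-unique m)))))
          (suc (exponents i′ j′ Φc)))
        (suc (N ∸ i′)))
      (suc N)
      where
      key₁ key₂ : Rel3 m × ℕ → ℕ
      key₁ (Z , _) = cZ Z (first source) (second source)
      key₂ (Z , _) = cZ Z (second source) zero

    -- An admissible pair is recovered from its insertion: Z by restriction, k′ from the new exponent vector.
    inserted-unique : AllPairs (λ Z Z′ → ¬ Z ≗₃ Z′) inserted
    inserted-unique = AllPairs-map⁺-on (insertPair R) distinct (All.map recover pairs-admissible) pairs-unique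
      where
      Recoverable : Rel3 m × ℕ → Set
      Recoverable (Z , k′) = IsTotalCyclicOrder Z × k′ ≡ mono3 i j k Φc
      recover : ∀ {p} → Admissible p → Recoverable p
      recover {Z , k′} (e1 , e2 , e3 , c , _ , p , q , r) =
        Cond-isTotalCyclicOrder source c ,
        trans (sym (Φmono-c (mono3 e1 e2 e3) k′)) (≗mono3 (Φmono Φa Φb Φc (mono3 e1 e2 e3) k′) p q r Φc)
      distinct : ∀ {p p′} → Recoverable p → Recoverable p′ → ¬ p ≈pair p′ → ¬ insertPair R p ≗₃ insertPair R p′
      distinct {Z , k′} {Z′ , k″} (tco , e) (tco′ , e′) p≉p′ eq =
        p≉p′ (≗₃-trans (≗₃-sym (restrict-insertPair R Z k′ tco))
                       (≗₃-trans (restrict-resp eq) (restrict-insertPair R Z′ k″ tco′)) ,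
              trans e (sym e′))

    Any-pairs : ∀ {P : Rel3 m × ℕ → Set} {e1 e2 e3 k′ Z} → Cond source w e1 e2 e3 Z → k′ ≤ mono3 e1 e2 e3 Φc →
      Φmono Φa Φb Φc (mono3 e1 e2 e3) k′ x₁ ≡ i → Φmono Φa Φb Φc (mono3 e1 e2 e3) k′ x₂ ≡ j →
      Φmono Φa Φb Φc (mono3 e1 e2 e3) k′ x₃ ≡ k → (∀ {Z′} → Z ≗₃ Z′ → P (Z′ , k′)) → Any P pairs
    Any-pairs {e1 = e1} {e2} {e3} {k′} {Z} c k′≤ p q r f
      with QPoly-indices {e1} {e2} {e3} (Gaps-sum source (Cond⇒Gaps source {w} c))
    ... | e1< , e2< , refl =
      Any-concatMap-upTo (λ i′ → concatMap (blocks i′) (upTo (suc (N ∸ i′)))) e1<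
        (Any-concatMap-upTo (blocks e1) e2< (Any-concatMap-upTo (block e1 e2) (s≤s k′≤)
          (select-Any (Φmono Φa Φb Φc (exponents e1 e2) k′) (map (_, k′) (sources e1 e2)) p q r
            (Any.map⁺ (Any-filter⁺ (Cond? source w e1 e2 (third e1 e2))
              (Any.map (λ e → f e , Cond-resp source e c) (allRel3-complete m Z)))))))

    inserted-complete : ∀ {Z′} (c : Cond η (w ∷ʳ ε) i j k Z′) → DeletedOrdered source Z′ (Cond-isTotalCyclicOrder η c) →
      Any (Z′ ≗₃_) inserted
    inserted-complete {Z′} c ordered =
      complete (deleted-Cond source ordered (InP-resp w restrict-Z′ (InP-∷ʳ⁻ˡ w ε Z′ (Cond-InP η c))))
      where
      open Deleted Z′ (Cond-isTotalCyclicOrder η c)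
      extendedGaps : ExtendedGaps η ε (suc m) (punchInℕ newPos (position deleted oA)) (punchInℕ newPos (position deleted oB))
                                  newPos i j k
      extendedGaps = ExtendedGaps-subst (cong (punchInℕ newPos) (sym (position-deleted oA)))
                                        (cong (punchInℕ newPos) (sym (position-deleted oB))) (ExtendedGaps-deleted c)
      complete : (∃ λ e1 → ∃ λ e2 → ∃ λ e3 → Cond source w e1 e2 e3 deleted) → Any (Z′ ≗₃_) inserted
      complete (e1 , e2 , e3 , c-deleted) = Any.map⁺ (Any-pairs c-deleted k′≤ gap-i gap-j gap-k Z′≗insertPair)
        where
        deletion = delete (Cond⇒Gaps source {w} c-deleted) extendedGaps
        k′≤ = proj₁ deletion
        newPos≡ = proj₁ (proj₂ deletion)
        gap-i = proj₁ (proj₂ (proj₂ deletion))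
        gap-j = proj₁ (proj₂ (proj₂ (proj₂ deletion)))
        gap-k = proj₂ (proj₂ (proj₂ (proj₂ deletion)))
        Z′≗insertPair : ∀ {Z} → deleted ≗₃ Z → Z′ ≗₃ insertPair R (Z , mono3 i j k Φc)
        Z′≗insertPair e = ≗₃-trans Z′≗insertAt (orderBy-resp (insertAt-cong
          (λ y → trans (sym (position-deleted y)) (position-resp e y))
          (trans (sym newPos≡) (cong (λ v → slot v (mono3 i j k Φc)) (position-resp e oB)))))

  module Target (η ε : Sign) (i j k : ℕ) where
    open CoefficientAt i j k

    orders : ℕ → ℕ → List (Rel3 (suc m))
    orders i′ j′ = filter (Cond? η (w ∷ʳ ε) i′ j′ (n ∸ i′ ∸ j′)) (allRel3 (suc m))

    block : ℕ → ℕ → List (Rel3 (suc m))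
    block i′ j′ = select (mono3 i′ j′ (n ∸ i′ ∸ j′)) (orders i′ j′)

    targets : List (Rel3 (suc m))
    targets = concatMap (λ i′ → concatMap (block i′) (upTo (suc (n ∸ i′)))) (upTo (suc n))

    targets-counted : CountedBy (Q η (w ∷ʳ ε)) targets
    targets-counted = subst (λ P → CountedBy P targets) (sym (Q≡QPoly η (w ∷ʳ ε)))
      (CountedBy-concatMap (λ i′ → map (term i′) (upTo (suc (n ∸ i′))))
                           (λ i′ → concatMap (block i′) (upTo (suc (n ∸ i′))))
        (λ i′ → CountedBy-map (term i′) (block i′)
          (λ j′ → CountedBy-term (length (orders i′ j′)) (mono3 i′ j′ (n ∸ i′ ∸ j′)) (orders i′ j′) refl)
          (upTo (suc (n ∸ i′))))
        (upTo (suc n)))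
      where
      term : ℕ → ℕ → ℤ × Mono
      term i′ j′ = ℤ.+ length (orders i′ j′) , mono3 i′ j′ (n ∸ i′ ∸ j′)

    All-block : ∀ {P : ℕ → ℕ → Rel3 (suc m) → Set} →
      (∀ {i′ j′ Z} → i′ ≡ i → j′ ≡ j → n ∸ i′ ∸ j′ ≡ k →
         Cond η (w ∷ʳ ε) i′ j′ (n ∸ i′ ∸ j′) Z → P i′ j′ Z) →
      ∀ i′ j′ → All (P i′ j′) (block i′ j′)
    All-block f i′ j′ = select-All (mono3 i′ j′ (n ∸ i′ ∸ j′)) (orders i′ j′)
      (λ p q r → All.map (f p q r) (All.all-filter (Cond? η (w ∷ʳ ε) i′ j′ (n ∸ i′ ∸ j′)) (allRel3 (suc m))))

    targets-Cond : All (Cond η (w ∷ʳ ε) i j k) targets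
    targets-Cond = All-concatMap-upTo (λ i′ → concatMap (block i′) (upTo (suc (n ∸ i′)))) (suc n) (λ {i′} _ →
      All-concatMap-upTo (block i′) (suc (n ∸ i′)) (λ {j′} _ → All-block (Cond-reindex η) i′ j′))

    targets-unique : AllPairs (λ Z Z′ → ¬ Z ≗₃ Z′) targets
    targets-unique = AllPairs-concatMap-keyed _≗₃_ key₁ (λ e → cZ-resp e _ _)
      (λ i′ → concatMap (block i′) (upTo (suc (n ∸ i′))))
      (λ i′ → All-concatMap-upTo (block i′) (suc (n ∸ i′)) (λ {j′} _ →
        All-block {P = λ i′ _ Z → key₁ Z ≡ i′} (λ _ _ _ c → proj₁ (proj₂ (Cond-OrderedGaps η {w ∷ʳ ε} c))) i′ j′))
      (λ i′ → AllPairs-concatMap-keyed _≗₃_ key₂ (λ e → cZ-resp e _ _) (block i′)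
        (All-block {P = λ _ j′ Z → key₂ Z ≡ j′}
                   (λ _ _ _ c → proj₁ (proj₂ (proj₂ (Cond-OrderedGaps η {w ∷ʳ ε} c)))) i′)
        (λ j′ → select-AllPairs (mono3 i′ j′ (n ∸ i′ ∸ j′)) (orders i′ j′)
                  (AllPairs.filter⁺ (Cond? η (w ∷ʳ ε) i′ j′ (n ∸ i′ ∸ j′)) (allRel3-unique (suc m))))
        (suc (n ∸ i′)))
      (suc n)
      where
      key₁ key₂ : Rel3 (suc m) → ℕ
      key₁ Z = cZ Z (first η) (second η)
      key₂ Z = cZ Z (second η) zero

    targets-complete : ∀ {Z′} → Cond η (w ∷ʳ ε) i j k Z′ → Any (Z′ ≗₃_) targets
    targets-complete {Z′} c =
      Any-concatMap-upTo (λ i′ → concatMap (block i′) (upTo (suc (n ∸ i′)))) i< (Any-concatMap-upTo (block i) j<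
        (select-Any (mono3 i j (n ∸ i ∸ j)) (orders i j) refl refl third≡
          (Any-filter⁺ (Cond? η (w ∷ʳ ε) i j (n ∸ i ∸ j))
            (Any.map (λ e → e , Cond-resp η e (Cond-reindex η refl refl (sym third≡) c)) (allRel3-complete (suc m) Z′)))))
      where
      indices = QPoly-indices {i} {j} {k} (Gaps-sum η (Cond⇒Gaps η {w ∷ʳ ε} c))
      i< = proj₁ indices
      j< = proj₁ (proj₂ indices)
      third≡ = proj₂ (proj₂ indices)

  open Enumeration (Rel3-setoid (suc m)) using (enumerations-length)

  Q-∷ʳ≈Φ : ∀ {η ε} (R : InsertionRule η ε) → let open InsertionRule R in
    (∀ {i j k Z′} (c : Cond η (w ∷ʳ ε) i j k Z′) → DeletedOrdered source Z′ (Cond-isTotalCyclicOrder η c)) →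
    (b≢c : Φb ≢ Φc) → Q η (w ∷ʳ ε) ≈P Φ Φa Φb Φc b≢c (Q source w)
  Q-∷ʳ≈Φ {η} {ε} R ordered b≢c i j k =
    trans targets-counted (trans (cong ℤ.+_ same-length) (sym (pairs-counted b≢c)))
    where
    open Target η ε i j k
    open Term R i j k
    same-length : length targets ≡ length pairs
    same-length =
      trans (enumerations-length (targets-Cond , targets-unique , λ _ → targets-complete)
                                 (inserted-Cond , inserted-unique , λ _ c → inserted-complete c (ordered c)))
            (List.length-map (insertPair R) pairs)

  Q-∷ʳ≈Φ⊞Φ : ∀ {η ε} (R R′ : InsertionRule η ε) → let open InsertionRule in source R ≢ source R′ →
    (b≢c : Φb R ≢ Φc R) (b≢c′ : Φb R′ ≢ Φc R′) →
    Q η (w ∷ʳ ε) ≈P (Φ (Φa R) (Φb R) (Φc R) b≢c (Q (source R) w) ⊞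
                     Φ (Φa R′) (Φb R′) (Φc R′) b≢c′ (Q (source R′) w))
  Q-∷ʳ≈Φ⊞Φ {η} {ε} R R′ sources≢ b≢c b≢c′ i j k =
    trans T.targets-counted (trans (cong ℤ.+_ same-length)
      (sym (trans (coeff-++ first-term second-term i j k) (cong₂ _+ℤ_ (S.pairs-counted b≢c) (S′.pairs-counted b≢c′)))))
    where
    open InsertionRule
    first-term = Φ (Φa R) (Φb R) (Φc R) b≢c (Q (source R) w)
    second-term = Φ (Φa R′) (Φb R′) (Φc R′) b≢c′ (Q (source R′) w)
    module T = Target η ε i j k
    module S = Term R i j k
    module S′ = Term R′ i j k
    -- the two lists restrict to orders of different classes
    disjoint : All (λ Z → All (λ Z′ → ¬ Z ≗₃ Z′) S′.inserted) S.inserted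
    disjoint = All.map⁺ (All.map (λ {p} a → All.map⁺ (All.map (λ {p′} a′ → separated p a p′ a′) S′.pairs-admissible))
                                 S.pairs-admissible)
      where
      separated : ∀ p → S.Admissible p → ∀ p′ → S′.Admissible p′ → ¬ insertPair R p ≗₃ insertPair R′ p′
      separated (Z , k′) (_ , _ , _ , c , _) (Z′ , k″) (_ , _ , _ , c′ , _) eq =
        sources≢ (Cond-class-unique (source R) (source R′) {w}
          (≗₃-trans (≗₃-sym (restrict-insertPair R Z k′ (Cond-isTotalCyclicOrder (source R) {w} c)))
                    (≗₃-trans (restrict-resp eq) (restrict-insertPair R′ Z′ k″ (Cond-isTotalCyclicOrder (source R′) {w} c′))))
          c c′)
    complete : ∀ Z′ → Cond η (w ∷ʳ ε) i j k Z′ → Any (Z′ ≗₃_) (S.inserted ++ S′.inserted)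
    complete Z′ c =
      [ (λ o → Any.++⁺ˡ (S.inserted-complete c o)) , (λ o → Any.++⁺ʳ S.inserted (S′.inserted-complete c o)) ]′
        (Ordered-either _ _ sources≢ q-oA≢q-oB)
      where open Deleted Z′ (Cond-isTotalCyclicOrder η c)
    same-length : length T.targets ≡ length S.pairs + length S′.pairs
    same-length =
      trans (enumerations-length (T.targets-Cond , T.targets-unique , λ _ → T.targets-complete)
                                 (All.++⁺ S.inserted-Cond S′.inserted-Cond ,
                                  AllPairs.++⁺ S.inserted-unique S′.inserted-unique disjoint , complete))
            (trans (List.length-++ S.inserted)
                   (cong₂ _+_ (List.length-map (insertPair R) S.pairs) (List.length-map (insertPair R′) S′.pairs)))

  deleted-Ordered-⊖⊕ : ∀ {i j k Z′} (c : Cond ⊖ (w ∷ʳ ⊕) i j k Z′) →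
    DeletedOrdered ⊕ Z′ (Cond-isTotalCyclicOrder ⊖ {w ∷ʳ ⊕} c)
  deleted-Ordered-⊖⊕ c = ExtendedGaps-⊖⊕⇒a<b (ExtendedGaps-deleted c) q-oA≢q-oB
    where open Deleted _ (Cond-isTotalCyclicOrder ⊖ {w ∷ʳ ⊕} c)

  deleted-Ordered-⊕⊖ : ∀ {i j k Z′} (c : Cond ⊕ (w ∷ʳ ⊖) i j k Z′) →
    DeletedOrdered ⊖ Z′ (Cond-isTotalCyclicOrder ⊕ {w ∷ʳ ⊖} c)
  deleted-Ordered-⊕⊖ c = ExtendedGaps-⊕⊖⇒b<a (ExtendedGaps-deleted c) q-oA≢q-oB
    where open Deleted _ (Cond-isTotalCyclicOrder ⊕ {w ∷ʳ ⊖} c)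

theorem3 : ∀ (n : ℕ) → 1 ≤ n → (w : Vec Sign n) →
    (Q⁺ (w ∷ʳ ⊕) ≈P (Φ x₂ x₂ x₁ (λ ()) (Q⁻ w) ⊞ Φ x₃ x₁ x₂ (λ ()) (Q⁺ w)))
    × (Q⁻ (w ∷ʳ ⊕) ≈P Φ x₁ x₁ x₃ (λ ()) (Q⁺ w))
    × (Q⁺ (w ∷ʳ ⊖) ≈P Φ x₁ x₁ x₂ (λ ()) (Q⁻ w))
    × (Q⁻ (w ∷ʳ ⊖) ≈P (Φ x₃ x₃ x₁ (λ ()) (Q⁺ w) ⊞ Φ x₂ x₁ x₃ (λ ()) (Q⁻ w)))
theorem3 (suc n′) _ w =
    Q-∷ʳ≈Φ⊞Φ rule-Φ221 rule-Φ312 (λ ()) (λ ()) (λ ())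
  , Q-∷ʳ≈Φ rule-Φ113 deleted-Ordered-⊖⊕ (λ ())
  , Q-∷ʳ≈Φ rule-Φ112 deleted-Ordered-⊕⊖ (λ ())
  , Q-∷ʳ≈Φ⊞Φ rule-Φ331 rule-Φ213 (λ ()) (λ ()) (λ ())
  where open Extension n′ w
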